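{- Under the change of variables below, for any word $x$ in the letters $\{\circ,\ast,\bullet\}$ of length $N-1$, $$q\,\widetilde T_0\big(F_{\circ x}(\mathbf z;t)\big)=F_{\bullet x}(\mathbf z;t).$$
   Context: Notation: identify $\circ=-1$, $\ast=0$, $\bullet=1$; $[N]=\{1,\dots,N\}$; juxtaposition is concatenation. Rhombic diagrams. For a word $\mu=(\mu_1,\dots,\mu_M)\in\{ -1,0,1\}^M$ with $r$ zeros, the rhombic diagram $\Gamma(\mu)$ is the planar region whose southeast border is the path starting at a point $P$ obtained by reading $\mu$ left to right and taking, for each $\mu_j=\pm1$, a unit south step followed by a unit west step, and for each $\mu_j=0$ a southwest step (vector $(-1,-1)$); its northwest border is the path from $P$ consisting of $M-r$ west steps, then $r$ southwest steps, then $M-r$ south steps. $\Gamma(\mu)$ is tiled by unit squares, horizontal rhombi (two horizontal and two diagonal edges) and vertical rhombi (two vertical and two diagonal edges). A west-strip is a maximal contiguous chain of squares and vertical rhombi consecutively adjacent along vertical edges; a north-strip is a maximal contiguous chain of squares and horizontal rhombi consecutively adjacent along horizontal edges. We use the distinguished tiling, in which every north-strip consists, from bottom to top, of squares followed by horizontal rhombi. Tiles adjacent to the southeast border are labeled $1,\dots,M$ from top to bottom; tile $j$ is a square if $\mu_j=\pm1$ and a rhombus if $\mu_j=0$. A rhombic staircase tableau of type $\mu$ is a filling of the tiles of $\Gamma(\mu)$ in which: each tile is empty or contains one letter from $\alpha,\beta,\gamma,\delta$; a southeast-border square labeled $j$ with $\mu_j=-1$ contains $\beta$ or $\gamma$;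 one with $\mu_j=1$ contains $\alpha$ or $\delta$; a horizontal rhombus may only contain $\alpha$ or $\gamma$; a vertical rhombus may only contain $\beta$ or $\delta$; every tile in the same north-strip as and above a tile containing $\alpha$ or $\gamma$ is empty; every tile in the same west-strip as and to the left of a tile containing $\beta$ or $\delta$ is empty. A tile "sees to its right" the content of the nearest nonempty tile to its right in its west-strip, and "sees below" the content of the nearest nonempty tile below it in its north-strip (if such exist). The weight $wt(T)$ is the product of all letters in $T$ times: each horizontal rhombus containing $\alpha$ gets $t$; each vertical rhombus containing $\beta$ gets $t$; each empty square seeing $\alpha$ or $\gamma$ to its right and $\alpha$ or $\delta$ below gets $t$; each empty square seeing $\beta$ to its right gets $t$; each empty vertical rhombus seeing $\beta$ to its right gets $t^2$; each empty vertical rhombus seeing $\alpha$ or $\gamma$ to its right gets $t$; each empty horizontal rhombus seeing $\alpha$ below gets $t^2$; each empty horizontal rhombus seeing $\beta$ or $\delta$ below gets $t$. $R(\mu)=\sum_T wt(T)$ over all rhombic staircase tableaux of type $\mu$ (if $\mu$ has no entries $\pm1$, including the empty word, $R(\mu)=1$). For $\mu$ of length $M$ with $r$ zeros, $\tilde R(\mu)=\frac{(t-1)^{M-r}}{\prod_{i=2r}^{M+r-1}(\alpha\beta t^i-\gamma\delta)}R(\mu)$. For $\mu\in\{ -1,0,1\}^N$, $S\subseteq[N]$, $\overline S=[N]\setminus S$, $\mu|_{\overline S}=(\mu_i)_{i\in\overline S}$, and $V=\{i:\mu_i=\pm1\}$, define $F_\mu(\mathbf z;t)=\sum_{S\subseteq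 V}\tilde R(\mu|_{\overline S})\prod_{i\in S}(z_i^{\mu_i}-1)$. Change of variables: $\alpha=\frac{ -ac(1-t)}{(a-1)(c-1)}$, $\gamma=\frac{1-t}{(a-1)(c-1)}$, $\beta=\frac{ -bd(1-t)}{(b-1)(d-1)}$, $\delta=\frac{1-t}{(b-1)(d-1)}$. Operators: $s_0f(z_1,z_2,\dots)=f(qz_1^{ -1},z_2,\dots)$ and $\widetilde T_0=-\frac{ac}{q}-\frac{(z_1-a)(z_1-c)}{z_1}\cdot\frac{1-s_0}{z_1-qz_1^{ -1}}$. -}

module Defs where

open import Data.Bool.Base using (Bool; true; false; _∧_; _∨_; not; if_then_else_)
open import Data.Nat.Base as ℕ using (ℕ; zero; suc; _≡ᵇ_; _≤ᵇ_)
open import Data.List.Base as List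
  using (List; []; _∷_; _++_; map; concatMap; upTo; downFrom; filterᵇ; foldr; reverse; length; applyUpTo)
open import Data.Maybe.Base using (Maybe; just; nothing)
open import Data.Product.Base using (_×_; _,_)
open import Data.Vec.Base as Vec using (Vec; []; _∷_; head; tail)
open import Data.Rational.Base using (ℚ; 0ℚ; 1ℚ; _+_; _*_; _-_; -_; 1/_; ≢-nonZero)
open import Data.Rational.Properties using (_≟_)
open import Relation.Nullary.Decidable.Core using (yes; no)

-- Letters ○ = -1, ∗ = 0, ● = 1
data Sign : Set where
  ○ ∗ ● : Sign

isP : Sign → Bool
isP ∗ = false
isP _ = true

isZero : Sign → Bool
isZero s = not (isP s)

-- letter at position p (0-based) of a word; ∗ outside the word (never used)
at : List Sign → ℕ → Sign
at []       _       = ∗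
at (s ∷ _)  zero    = s
at (_ ∷ w)  (suc p) = at w p

-- total inverse (inv 0 = 0); only used at points where the argument is
-- nonzero (guaranteed by the hypotheses of the theorem)
inv : ℚ → ℚ
inv p with p ≟ 0ℚ
... | yes _  = 0ℚ
... | no p≢0 = 1/_ p {{≢-nonZero p≢0}}

_^_ : ℚ → ℕ → ℚ
p ^ zero  = 1ℚ
p ^ suc n = p * (p ^ n)

allᵇ : {A : Set} → (A → Bool) → List A → Bool
allᵇ p []       = true
allᵇ p (x ∷ xs) = p x ∧ allᵇ p xs

sumℚ : List ℚ → ℚ
sumℚ = foldr _+_ 0ℚ

prodℚ : List ℚ → ℚ
prodℚ = foldr _*_ 1ℚ

-- Positions of μ are 0,…,M-1.  Reading the southeast border, a ±1 at
-- position p gives a south edge v_p and a west edge h_p, a 0 at position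
-- p gives a diagonal edge d_p.  Tiles of the tiling correspond to pairs
-- of border edges whose strips cross, indexed by (p , q) with p ≤ q:
--   * square          (v_p , h_q)  : μ_p , μ_q ∈ {±1}, p ≤ q
--   * vertical rhombus (v_p , d_q) : μ_p ∈ {±1}, μ_q = 0, p < q
--   * horizontal rhombus (d_p , h_q): μ_p = 0, μ_q ∈ {±1}, p < q
-- The southeast-border square labelled j (μ_j = ±1) is (j , j).

Tile : Set
Tile = ℕ × ℕ

tiles : List Sign → List Tile
tiles μ = concatMap (λ q → concatMap (λ p →
            if isP (at μ p) ∨ isP (at μ q) then (p , q) ∷ [] else [])
            (upTo (suc q))) (upTo (length μ))

data Kind : Set where
  square hrh vrh : Kind

kindB : Bool → Bool → Kind
kindB true  true  = square
kindB true  false = vrh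
kindB false true  = hrh
kindB false false = square   -- does not occur for tiles

kind : List Sign → Tile → Kind
kind μ (p , q) = kindB (isP (at μ p)) (isP (at μ q))

-- West-strip of v_p (μ_p = ±1), listed from right (the SE border) to left.
westStrip : List Sign → ℕ → List Tile
westStrip μ p = map (λ q → (p , q)) (filterᵇ (λ q → p ≤ᵇ q) (upTo (length μ)))

-- North-strip of h_q (μ_q = ±1), listed from bottom to top; in the
-- distinguished tiling: squares first, then horizontal rhombi.
northStrip : List Sign → ℕ → List Tile
northStrip μ q =
  map (λ p → (p , q)) (filterᵇ (λ p → isP (at μ p)) (downFrom (suc q)))
  ++ map (λ p → (p , q)) (filterᵇ (λ p → isZero (at μ p)) (downFrom q))

_==T_ : Tile → Tile → Bool
(p , q) ==T (p′ , q′) = (p ≡ᵇ p′) ∧ (q ≡ᵇ q′)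

before : Tile → List Tile → List Tile
before x []       = []
before x (y ∷ ys) = if y ==T x then [] else y ∷ before x ys

after : Tile → List Tile → List Tile
after x []       = []
after x (y ∷ ys) = if y ==T x then ys else after x ys

data Letter : Set where
  α β γ δ : Letter

Content : Set
Content = Maybe Letter

allContents : List Content
allContents = nothing ∷ just α ∷ just β ∷ just γ ∷ just δ ∷ []

Filling : Set
Filling = Tile → Content

fillings : List Tile → List Filling
fillings []       = (λ _ → nothing) ∷ []
fillings (x ∷ xs) = concatMap (λ f →
  map (λ c → λ y → if y ==T x then c else f y) allContents) (fillings xs)

isEmpty : Content → Bool
isEmpty nothing = true
isEmpty _       = false

isαγ : Content → Bool
isαγ (just α) = true
isαγ (just γ) = true
isαγ _        = false

isβδ : Content → Bool
isβδ (just β) = true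
isβδ (just δ) = true
isβδ _        = false

isαδ : Content → Bool
isαδ (just α) = true
isαδ (just δ) = true
isαδ _        = false

isβγ : Content → Bool
isβγ (just β) = true
isβγ (just γ) = true
isβγ _        = false

isα : Content → Bool
isα (just α) = true
isα _        = false

isβ : Content → Bool
isβ (just β) = true
isβ _        = false

firstNonEmpty : Filling → List Tile → Content
firstNonEmpty f []       = nothing
firstNonEmpty f (x ∷ xs) with f x
... | nothing = firstNonEmpty f xs
... | just ℓ  = just ℓ

seesRight : List Sign → Filling → Tile → Content
seesRight μ f (p , q) = firstNonEmpty f (reverse (before (p , q) (westStrip μ p)))

seesBelow : List Sign → Filling → Tile → Content
seesBelow μ f (p , q) = firstNonEmpty f (reverse (before (p , q) (northStrip μ q)))

borderOK : Sign → Content → Bool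
borderOK ○ c = isβγ c
borderOK ● c = isαδ c
borderOK ∗ c = true

kindOK : Kind → Content → Bool
kindOK square c = true
kindOK hrh    c = isEmpty c ∨ isαγ c
kindOK vrh    c = isEmpty c ∨ isβδ c

validTile : List Sign → Filling → Tile → Bool
validTile μ f (p , q) =
  (if p ≡ᵇ q then borderOK (at μ p) (f (p , q)) else true)
  ∧ kindOK (kind μ (p , q)) (f (p , q))
  ∧ (if isαγ (f (p , q)) then allᵇ (λ y → isEmpty (f y)) (after (p , q) (northStrip μ q)) else true)
  ∧ (if isβδ (f (p , q)) then allᵇ (λ y → isEmpty (f y)) (after (p , q) (westStrip μ p)) else true)

isTableau : List Sign → Filling → Bool
isTableau μ f = allᵇ (validTile μ f) (tiles μ)

-- Weights, evaluated at values A B G D T of α β γ δ t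

letterVal : ℚ → ℚ → ℚ → ℚ → Letter → ℚ
letterVal A B G D α = A
letterVal A B G D β = B
letterVal A B G D γ = G
letterVal A B G D δ = D

tIf : ℚ → Bool → ℚ
tIf T b = if b then T else 1ℚ

tileWt : (A B G D T : ℚ) → List Sign → Filling → Tile → ℚ
tileWt A B G D T μ f x with f x | kind μ x
... | just ℓ | k = letterVal A B G D ℓ * extra ℓ k
  where
  extra : Letter → Kind → ℚ
  extra α hrh = T
  extra β vrh = T
  extra _ _   = 1ℚ
... | nothing | square =
  tIf T (isαγ (seesRight μ f x) ∧ isαδ (seesBelow μ f x)) * tIf T (isβ (seesRight μ f x))
... | nothing | vrh =
  tIf (T * T) (isβ (seesRight μ f x)) * tIf T (isαγ (seesRight μ f x))
... | nothing | hrh =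
  tIf (T * T) (isα (seesBelow μ f x)) * tIf T (isβδ (seesBelow μ f x))

wt : (A B G D T : ℚ) → List Sign → Filling → ℚ
wt A B G D T μ f = prodℚ (map (tileWt A B G D T μ f) (tiles μ))

R : (A B G D T : ℚ) → List Sign → ℚ
R A B G D T μ = sumℚ (map (wt A B G D T μ) (filterᵇ (isTableau μ) (fillings (tiles μ))))

zeros : List Sign → ℕ
zeros μ = length (filterᵇ isZero μ)

Rt : (A B G D T : ℚ) → List Sign → ℚ
Rt A B G D T μ =
  ((T - 1ℚ) ^ (M ℕ.∸ r))
  * inv (prodℚ (applyUpTo (λ k → A * B * (T ^ (2 ℕ.* r ℕ.+ k)) - G * D) (M ℕ.∸ r)))
  * R A B G D T μ
  where
  M = length μ
  r = zeros μ

-- F_μ(z;t) = Σ_{S ⊆ V} R̃(μ|_{S̄}) ∏_{i∈S} (z_i^{μ_i} - 1)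
-- terms μ z enumerates, for each S ⊆ V, the pair (μ|_{S̄} , ∏_{i∈S}(z_i^{μ_i}-1)).

terms : ∀ {m} → Vec Sign m → Vec ℚ m → List (List Sign × ℚ)
terms []      []       = ([] , 1ℚ) ∷ []
terms (∗ ∷ μ) (z ∷ zs) = map (λ { (w , c) → (∗ ∷ w , c) }) (terms μ zs)
terms (○ ∷ μ) (z ∷ zs) =
  map (λ { (w , c) → (○ ∷ w , c) }) (terms μ zs)
  ++ map (λ { (w , c) → (w , (inv z - 1ℚ) * c) }) (terms μ zs)
terms (● ∷ μ) (z ∷ zs) =
  map (λ { (w , c) → (● ∷ w , c) }) (terms μ zs)
  ++ map (λ { (w , c) → (w , (z - 1ℚ) * c) }) (terms μ zs)

F : (A B G D T : ℚ) → ∀ {m} → Vec Sign m → Vec ℚ m → ℚ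
F A B G D T μ z = sumℚ (map (λ { (w , c) → Rt A B G D T w * c }) (terms μ z))

αv γv βv δv : (a b c d t : ℚ) → ℚ
αv a b c d t = - (a * c * (1ℚ - t)) * inv ((a - 1ℚ) * (c - 1ℚ))
γv a b c d t = (1ℚ - t) * inv ((a - 1ℚ) * (c - 1ℚ))
βv a b c d t = - (b * d * (1ℚ - t)) * inv ((b - 1ℚ) * (d - 1ℚ))
δv a b c d t = (1ℚ - t) * inv ((b - 1ℚ) * (d - 1ℚ))

Fabcd : (a b c d t : ℚ) → ∀ {m} → Vec Sign m → Vec ℚ m → ℚ
Fabcd a b c d t = F (αv a b c d t) (βv a b c d t) (γv a b c d t) (δv a b c d t) t

den : (a b c d t : ℚ) → ℕ → ℚ
den a b c d t i = αv a b c d t * βv a b c d t * (t ^ i) - γv a b c d t * δv a b c d t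

s₀ : (q : ℚ) → ∀ {n} → (Vec ℚ (suc n) → ℚ) → Vec ℚ (suc n) → ℚ
s₀ q f z = f (q * inv (head z) ∷ tail z)

T̃₀ : (a c q : ℚ) → ∀ {n} → (Vec ℚ (suc n) → ℚ) → Vec ℚ (suc n) → ℚ
T̃₀ a c q f z =
  - (a * c * inv q) * f z
  - ((z₁ - a) * (z₁ - c) * inv z₁) * ((f z - s₀ q f z) * inv (z₁ - q * inv z₁))
  where
  z₁ = head z

{-# OPTIONS --safe #-}
-- R(μ) is an iterated sum, tile by tile, of the weight of a filling that is a tableau. For a
-- particle s, Γ(s w) is a copy of Γ(w) shifted by one row and one column, plus the corner
-- tile (0 , 0) and a new top row of tiles (0 , q + 1). Split R(● w) and R(○ w) by the content
-- of the corner. An α in the corner of Γ(● w) and a γ in the corner of Γ(○ w) impose the same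
-- conditions and weights on all other tiles, so these parts satisfy γ·(…) = α·(…). A δ or β
-- in the corner forces the top row to be empty and leaves an arbitrary tableau of type w
-- below it; the empty row weighs 1 next to δ, and t^{|w| + r} next to β, where r is the
-- number of ∗ in w (t for each square, t² for each vertical rhombus). Hence
--   γ R(● w) − α R(○ w) = (γδ − αβ t^{|w| + r}) R(w),
-- which after normalisation and the change of variables reads
--   R̃(● w) = − ac R̃(○ w) + (1 − a)(1 − c) R̃(w).
-- Splitting the subsets S by whether they contain position 1 writes F_{s x} as
-- Σ R̃(s w) c + (z₁^s − 1) Σ R̃(w) c, and q T̃₀ of such an affine function of z₁⁻¹ is computed
-- directly.
module Submission where

open import Defs
open import Data.Nat.Base using (ℕ; suc; _<_; _*_)
open import Data.Vec.Base using (Vec; _∷_; head; lookup)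
open import Data.Rational.Base using (ℚ; 0ℚ; 1ℚ) renaming (_*_ to _*ℚ_; _-_ to _-ℚ_)
open import Relation.Binary.PropositionalEquality using (_≡_; _≢_)

open import Algebra.Bundles using (CommutativeMonoid)
open import Data.Bool.Base using (Bool; true; false; _∧_; _∨_; if_then_else_)
open import Data.Bool.Properties using (T-≡; ¬-not)
open import Data.Empty using (⊥-elim)
open import Data.Fin.Base using (zero)
open import Data.List.Base using (List; []; _∷_; _++_; map; concatMap; upTo; downFrom; filterᵇ; reverse; length; applyUpTo)
import Data.List.Properties as List
open import Data.List.Relation.Binary.Permutation.Propositional using (↭-sym)
open import Data.List.Relation.Binary.Permutation.Propositional.Properties using (All-resp-↭; ↭-reverse)
open import Data.List.Relation.Unary.All as All using (All; []; _∷_)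
import Data.List.Relation.Unary.All.Properties as All
open import Data.List.Relation.Unary.AllPairs using ([]; _∷_)
open import Data.List.Relation.Unary.Unique.Propositional using (Unique)
open import Data.List.Relation.Unary.Unique.Propositional.Properties using (upTo⁺)
open import Data.Maybe.Base using (just; nothing)
open import Data.Nat.Base as ℕ using (zero; _≤_; z≤n; s≤s; _∸_; _≡ᵇ_; _≤ᵇ_)
import Data.Nat.Properties as ℕₚ
open import Data.Product.Base using (_×_; _,_; proj₁; proj₂)
open import Data.Rational.Base using (_+_; -_; ≢-nonZero)
import Data.Rational.Properties as ℚₚ
open import Algebra.Properties.CommutativeSemigroup (CommutativeMonoid.commutativeSemigroup ℚₚ.*-1-commutativeMonoid)
  using (interchange; x∙yz≈y∙xz)
open import Algebra.Properties.Group ℚₚ.+-0-group using (x∙y⁻¹≈ε⇒x≈y)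
open import Data.Rational.Solver using (module +-*-Solver)
open import Data.Vec.Base using ([])
open import Function.Base using (_∘_)
open import Function.Bundles using (Equivalence)
open import Relation.Binary.PropositionalEquality using (refl; sym; trans; cong; cong₂; subst; module ≡-Reasoning)
open import Relation.Nullary.Decidable.Core using (Dec; yes; no; T?)

open +-*-Solver using (solve; _:=_; _:+_; _:*_; _:-_; :-_; con)
open ≡-Reasoning

sumℚ-++ : (xs ys : List ℚ) → sumℚ (xs ++ ys) ≡ sumℚ xs + sumℚ ys
sumℚ-++ []       ys = sym (ℚₚ.+-identityˡ _)
sumℚ-++ (x ∷ xs) ys = trans (cong (x +_) (sumℚ-++ xs ys)) (sym (ℚₚ.+-assoc x _ _))

prodℚ-++ : (xs ys : List ℚ) → prodℚ (xs ++ ys) ≡ prodℚ xs *ℚ prodℚ ys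
prodℚ-++ []       ys = sym (ℚₚ.*-identityˡ _)
prodℚ-++ (x ∷ xs) ys = trans (cong (x *ℚ_) (prodℚ-++ xs ys)) (sym (ℚₚ.*-assoc x _ _))

sumℚ-concatMap : ∀ {X Y : Set} (h : Y → ℚ) (k : X → List Y) xs →
  sumℚ (map h (concatMap k xs)) ≡ sumℚ (map (λ x → sumℚ (map h (k x))) xs)
sumℚ-concatMap h k []       = refl
sumℚ-concatMap h k (x ∷ xs) = begin
  sumℚ (map h (k x ++ concatMap k xs))
    ≡⟨ cong sumℚ (List.map-++ h (k x) (concatMap k xs)) ⟩
  sumℚ (map h (k x) ++ map h (concatMap k xs))
    ≡⟨ sumℚ-++ (map h (k x)) _ ⟩
  sumℚ (map h (k x)) + sumℚ (map h (concatMap k xs))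
    ≡⟨ cong (sumℚ (map h (k x)) +_) (sumℚ-concatMap h k xs) ⟩
  sumℚ (map h (k x)) + sumℚ (map (λ x → sumℚ (map h (k x))) xs) ∎

prodℚ-concatMap : ∀ {X Y : Set} (h : Y → ℚ) (k : X → List Y) xs →
  prodℚ (map h (concatMap k xs)) ≡ prodℚ (map (λ x → prodℚ (map h (k x))) xs)
prodℚ-concatMap h k []       = refl
prodℚ-concatMap h k (x ∷ xs) = begin
  prodℚ (map h (k x ++ concatMap k xs))
    ≡⟨ cong prodℚ (List.map-++ h (k x) (concatMap k xs)) ⟩
  prodℚ (map h (k x) ++ map h (concatMap k xs))
    ≡⟨ prodℚ-++ (map h (k x)) _ ⟩
  prodℚ (map h (k x)) *ℚ prodℚ (map h (concatMap k xs))
    ≡⟨ cong (prodℚ (map h (k x)) *ℚ_) (prodℚ-concatMap h k xs) ⟩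
  prodℚ (map h (k x)) *ℚ prodℚ (map (λ x → prodℚ (map h (k x))) xs) ∎

sumℚ-filterᵇ : ∀ {X : Set} (h : X → ℚ) (p : X → Bool) xs →
  sumℚ (map h (filterᵇ p xs)) ≡ sumℚ (map (λ x → if p x then h x else 0ℚ) xs)
sumℚ-filterᵇ h p []       = refl
sumℚ-filterᵇ h p (x ∷ xs) with p x
... | true  = cong (h x +_) (sumℚ-filterᵇ h p xs)
... | false = trans (sumℚ-filterᵇ h p xs) (sym (ℚₚ.+-identityˡ _))

sumℚ-linear : ∀ {X : Set} (a b : ℚ) (u v : X → ℚ) xs →
  sumℚ (map (λ x → a *ℚ u x + b *ℚ v x) xs) ≡ a *ℚ sumℚ (map u xs) + b *ℚ sumℚ (map v xs)
sumℚ-linear a b u v []       = solve 2 (λ a b → con 0ℚ := a :* con 0ℚ :+ b :* con 0ℚ) refl a b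
sumℚ-linear a b u v (x ∷ xs) =
  trans (cong (a *ℚ u x + b *ℚ v x +_) (sumℚ-linear a b u v xs))
        (solve 6 (λ a b ux vx su sv → (a :* ux :+ b :* vx) :+ (a :* su :+ b :* sv)
                                      := a :* (ux :+ su) :+ b :* (vx :+ sv))
               refl a b (u x) (v x) (sumℚ (map u xs)) (sumℚ (map v xs)))

sumℚ-*ˡ : ∀ {X : Set} (a : ℚ) (u : X → ℚ) xs →
  sumℚ (map (λ x → a *ℚ u x) xs) ≡ a *ℚ sumℚ (map u xs)
sumℚ-*ˡ a u []       = sym (ℚₚ.*-zeroʳ a)
sumℚ-*ˡ a u (x ∷ xs) =
  trans (cong (a *ℚ u x +_) (sumℚ-*ˡ a u xs)) (sym (ℚₚ.*-distribˡ-+ a (u x) _))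

prodℚ-* : ∀ {X : Set} (u v : X → ℚ) xs →
  prodℚ (map (λ x → u x *ℚ v x) xs) ≡ prodℚ (map u xs) *ℚ prodℚ (map v xs)
prodℚ-* u v []       = refl
prodℚ-* u v (x ∷ xs) =
  trans (cong (u x *ℚ v x *ℚ_) (prodℚ-* u v xs))
        (interchange (u x) (v x) (prodℚ (map u xs)) (prodℚ (map v xs)))

allᵇ-++ : ∀ {X : Set} (p : X → Bool) xs ys → allᵇ p (xs ++ ys) ≡ (allᵇ p xs ∧ allᵇ p ys)
allᵇ-++ p []       ys = refl
allᵇ-++ p (x ∷ xs) ys with p x
... | true  = allᵇ-++ p xs ys
... | false = refl

allᵇ-concatMap : ∀ {X Y : Set} (p : Y → Bool) (k : X → List Y) xs →
  allᵇ p (concatMap k xs) ≡ allᵇ (λ x → allᵇ p (k x)) xs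
allᵇ-concatMap p k []       = refl
allᵇ-concatMap p k (x ∷ xs) =
  trans (allᵇ-++ p (k x) (concatMap k xs)) (cong (allᵇ p (k x) ∧_) (allᵇ-concatMap p k xs))

allᵇ-map : ∀ {X Y : Set} (p : Y → Bool) (f : X → Y) xs → allᵇ p (map f xs) ≡ allᵇ (p ∘ f) xs
allᵇ-map p f []       = refl
allᵇ-map p f (x ∷ xs) = cong (p (f x) ∧_) (allᵇ-map p f xs)

allᵇ-cong : ∀ {X : Set} {p p′ : X → Bool} → (∀ x → p x ≡ p′ x) → ∀ xs → allᵇ p xs ≡ allᵇ p′ xs
allᵇ-cong e []       = refl
allᵇ-cong e (x ∷ xs) = cong₂ _∧_ (e x) (allᵇ-cong e xs)

allᵇ-cong-local : ∀ {X : Set} {p p′ : X → Bool} {xs} → All (λ x → p x ≡ p′ x) xs → allᵇ p xs ≡ allᵇ p′ xs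
allᵇ-cong-local []       = refl
allᵇ-cong-local (e ∷ es) = cong₂ _∧_ e (allᵇ-cong-local es)

prodℚ-cong-local : ∀ {X : Set} {u v : X → ℚ} {xs} → All (λ x → u x ≡ v x) xs → prodℚ (map u xs) ≡ prodℚ (map v xs)
prodℚ-cong-local = cong prodℚ ∘ List.map-cong-local

filterᵇ-map : ∀ {X Y : Set} {p : Y → Bool} {p′ : X → Bool} (f : X → Y) → (∀ x → p (f x) ≡ p′ x) →
  ∀ xs → filterᵇ p (map f xs) ≡ map f (filterᵇ p′ xs)
filterᵇ-map {p = p} {p′} f e []       = refl
filterᵇ-map {p = p} {p′} f e (x ∷ xs) with p (f x) | p′ x | e x
... | true  | true  | refl = cong (f x ∷_) (filterᵇ-map f e xs)
... | false | false | refl = filterᵇ-map f e xs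

downFrom-suc : ∀ n → downFrom (suc n) ≡ map suc (downFrom n) ++ 0 ∷ []
downFrom-suc zero    = refl
downFrom-suc (suc n) = cong (suc n ∷_) (downFrom-suc n)

applyUpTo-at : ∀ w → applyUpTo (at w) (length w) ≡ w
applyUpTo-at []      = refl
applyUpTo-at (s ∷ w) = cong (s ∷_) (applyUpTo-at w)

prodℚ-applyUpTo-suc : ∀ (h : ℕ → ℚ) n → prodℚ (applyUpTo h (suc n)) ≡ prodℚ (applyUpTo h n) *ℚ h n
prodℚ-applyUpTo-suc h n = begin
  prodℚ (applyUpTo h (suc n))          ≡⟨ cong prodℚ (List.applyUpTo-∷ʳ h n) ⟨
  prodℚ (applyUpTo h n ++ h n ∷ [])    ≡⟨ prodℚ-++ (applyUpTo h n) (h n ∷ []) ⟩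
  prodℚ (applyUpTo h n) *ℚ (h n *ℚ 1ℚ) ≡⟨ cong (prodℚ (applyUpTo h n) *ℚ_) (ℚₚ.*-identityʳ (h n)) ⟩
  prodℚ (applyUpTo h n) *ℚ h n         ∎

≡ᵇ-refl : ∀ n → (n ≡ᵇ n) ≡ true
≡ᵇ-refl n = Equivalence.to T-≡ (ℕₚ.≡⇒≡ᵇ n n refl)

≢⇒≡ᵇ-false : ∀ {m n} → m ≢ n → (m ≡ᵇ n) ≡ false
≢⇒≡ᵇ-false {m} {n} m≢n = ¬-not (λ e → m≢n (ℕₚ.≡ᵇ⇒≡ m n (Equivalence.from T-≡ e)))

inv-inverseʳ : ∀ x → x ≢ 0ℚ → x *ℚ inv x ≡ 1ℚ
inv-inverseʳ x x≢0 with x ℚₚ.≟ 0ℚ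
... | yes x≡0  = ⊥-elim (x≢0 x≡0)
... | no  x≢0′ = ℚₚ.*-inverseʳ x {{≢-nonZero x≢0′}}

inv-inverseˡ : ∀ x → x ≢ 0ℚ → inv x *ℚ x ≡ 1ℚ
inv-inverseˡ x x≢0 = trans (ℚₚ.*-comm (inv x) x) (inv-inverseʳ x x≢0)

*-cancelˡ : ∀ x {u v} → x ≢ 0ℚ → x *ℚ u ≡ x *ℚ v → u ≡ v
*-cancelˡ x {u} {v} x≢0 xu≡xv = begin
  u                  ≡⟨ ℚₚ.*-identityˡ u ⟨
  1ℚ *ℚ u            ≡⟨ cong (_*ℚ u) (inv-inverseˡ x x≢0) ⟨
  inv x *ℚ x *ℚ u    ≡⟨ ℚₚ.*-assoc (inv x) x u ⟩
  inv x *ℚ (x *ℚ u)  ≡⟨ cong (inv x *ℚ_) xu≡xv ⟩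
  inv x *ℚ (x *ℚ v)  ≡⟨ ℚₚ.*-assoc (inv x) x v ⟨
  inv x *ℚ x *ℚ v    ≡⟨ cong (_*ℚ v) (inv-inverseˡ x x≢0) ⟩
  1ℚ *ℚ v            ≡⟨ ℚₚ.*-identityˡ v ⟩
  v                  ∎

*-≢0 : ∀ {x y} → x ≢ 0ℚ → y ≢ 0ℚ → x *ℚ y ≢ 0ℚ
*-≢0 {x} x≢0 y≢0 xy≡0 = y≢0 (*-cancelˡ x x≢0 (trans xy≡0 (sym (ℚₚ.*-zeroʳ x))))

-≢0 : ∀ {x y} → x ≢ y → x -ℚ y ≢ 0ℚ
-≢0 {x} {y} x≢y = x≢y ∘ x∙y⁻¹≈ε⇒x≈y x y

inv-unique : ∀ x u → x ≢ 0ℚ → x *ℚ u ≡ 1ℚ → inv x ≡ u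
inv-unique x u x≢0 xu≡1 = *-cancelˡ x x≢0 (trans (inv-inverseʳ x x≢0) (sym xu≡1))

inv-≢0 : ∀ {x} → x ≢ 0ℚ → inv x ≢ 0ℚ
inv-≢0 {x} x≢0 inv≡0 = ℚₚ.1≢0 (trans (sym (inv-inverseʳ x x≢0)) (trans (cong (x *ℚ_) inv≡0) (ℚₚ.*-zeroʳ x)))

inv-involutive : ∀ x → x ≢ 0ℚ → inv (inv x) ≡ x
inv-involutive x x≢0 = inv-unique (inv x) x (inv-≢0 x≢0) (inv-inverseˡ x x≢0)

inv-* : ∀ x y → inv (x *ℚ y) ≡ inv x *ℚ inv y
inv-* x y = by-cases (x ℚₚ.≟ 0ℚ) (y ℚₚ.≟ 0ℚ)
  where
  by-cases : Dec (x ≡ 0ℚ) → Dec (y ≡ 0ℚ) → inv (x *ℚ y) ≡ inv x *ℚ inv y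
  by-cases (yes x≡0) _ rewrite x≡0 = trans (cong inv (ℚₚ.*-zeroˡ y)) (sym (ℚₚ.*-zeroˡ (inv y)))
  by-cases (no _) (yes y≡0) rewrite y≡0 = trans (cong inv (ℚₚ.*-zeroʳ x)) (sym (ℚₚ.*-zeroʳ (inv x)))
  by-cases (no x≢0) (no y≢0) = inv-unique (x *ℚ y) (inv x *ℚ inv y) (*-≢0 x≢0 y≢0) (begin
    x *ℚ y *ℚ (inv x *ℚ inv y)
      ≡⟨ solve 4 (λ x y x⁻¹ y⁻¹ → x :* y :* (x⁻¹ :* y⁻¹) := (x :* x⁻¹) :* (y :* y⁻¹)) refl x y (inv x) (inv y) ⟩
    (x *ℚ inv x) *ℚ (y *ℚ inv y)
      ≡⟨ cong₂ _*ℚ_ (inv-inverseʳ x x≢0) (inv-inverseʳ y y≢0) ⟩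
    1ℚ ∎)

update : Filling → Tile → Content → Filling
update f x c y = if y ==T x then c else f y

emptyFilling : Filling
emptyFilling _ = nothing

-- validTile μ f (p , q) is definitionally validTileOf applied to its border test, the kind and
-- content of the tile, and its north-strip and west-strip conditions.
validTileOf : Bool → Kind → Content → Bool → Bool → Bool
validTileOf border k c north west = border ∧ kindOK k c ∧ (if isαγ c then north else true) ∧ (if isβδ c then west else true)

All-before : ∀ {P : Tile → Set} y {l} → All P l → All P (before y l)
All-before y [] = []
All-before y {x ∷ l} (px ∷ pl) with x ==T y
... | true  = []
... | false = px ∷ All-before y pl

firstNonEmpty-skip : ∀ (g : Filling) {l} r → All (λ y → g y ≡ nothing) l → firstNonEmpty g (l ++ r) ≡ firstNonEmpty g r
firstNonEmpty-skip g r [] = refl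
firstNonEmpty-skip g {y ∷ l} r (e ∷ es) with g y | e
... | nothing | refl = firstNonEmpty-skip g r es

firstNonEmpty-cong-local : ∀ {g g′ : Filling} {l} → All (λ y → g y ≡ g′ y) l → firstNonEmpty g l ≡ firstNonEmpty g′ l
firstNonEmpty-cong-local [] = refl
firstNonEmpty-cong-local {g} {g′} {y ∷ l} (e ∷ es) with g y | g′ y | e
... | nothing | .nothing | refl = firstNonEmpty-cong-local es
... | just ℓ  | .(just ℓ) | refl = refl

isEmpty⇒≡nothing : ∀ {c} → isEmpty c ≡ true → c ≡ nothing
isEmpty⇒≡nothing {nothing} _ = refl

data SameUpToαγ : Content → Content → Set where
  same : ∀ {c} → SameUpToαγ c c
  αγ   : SameUpToαγ (just α) (just γ)

firstNonEmpty-similar : ∀ {g g′ : Filling} → (∀ y → SameUpToαγ (g y) (g′ y)) →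
  ∀ l → SameUpToαγ (firstNonEmpty g l) (firstNonEmpty g′ l)
firstNonEmpty-similar sim [] = same
firstNonEmpty-similar {g} {g′} sim (y ∷ l) with g y | g′ y | sim y
... | nothing | .nothing  | same = firstNonEmpty-similar sim l
... | just ℓ  | .(just ℓ) | same = same
... | just α  | just γ    | αγ   = αγ

isEmpty-similar : ∀ {c c′} → SameUpToαγ c c′ → isEmpty c ≡ isEmpty c′
isEmpty-similar same = refl
isEmpty-similar αγ   = refl

-- Iterated sums over fillings

sumTile : Tile → (Filling → ℚ) → Filling → ℚ
sumTile x h f = sumℚ (map (λ c → h (update f x c)) allContents)

sumTiles : List Tile → (Filling → ℚ) → Filling → ℚ
sumTiles []       h = h
sumTiles (x ∷ xs) h = sumTiles xs (sumTile x h)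

sum-fillings : ∀ xs h → sumℚ (map h (fillings xs)) ≡ sumTiles xs h emptyFilling
sum-fillings []       h = ℚₚ.+-identityʳ (h emptyFilling)
sum-fillings (x ∷ xs) h = trans (sumℚ-concatMap h _ (fillings xs)) (sum-fillings xs (sumTile x h))

sumTiles-cong : ∀ xs {h h′ : Filling → ℚ} → (∀ f → h f ≡ h′ f) → ∀ g → sumTiles xs h g ≡ sumTiles xs h′ g
sumTiles-cong []       e = e
sumTiles-cong (x ∷ xs) e =
  sumTiles-cong xs (λ f → cong sumℚ (List.map-cong (λ c → e (update f x c)) allContents))

sumTiles-++ : ∀ xs ys h → sumTiles (xs ++ ys) h ≡ sumTiles ys (sumTiles xs h)
sumTiles-++ []       ys h = refl
sumTiles-++ (x ∷ xs) ys h = sumTiles-++ xs ys (sumTile x h)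

sumTiles-linear : ∀ xs (a b : ℚ) u v g →
  sumTiles xs (λ f → a *ℚ u f + b *ℚ v f) g ≡ a *ℚ sumTiles xs u g + b *ℚ sumTiles xs v g
sumTiles-linear []       a b u v g = refl
sumTiles-linear (x ∷ xs) a b u v g =
  trans (sumTiles-cong xs (λ f → sumℚ-linear a b (λ c → u (update f x c)) (λ c → v (update f x c)) allContents) g)
        (sumTiles-linear xs a b (sumTile x u) (sumTile x v) g)

sumTiles-*ˡ : ∀ xs (a : ℚ) u g → sumTiles xs (λ f → a *ℚ u f) g ≡ a *ℚ sumTiles xs u g
sumTiles-*ˡ []       a u g = refl
sumTiles-*ˡ (x ∷ xs) a u g =
  trans (sumTiles-cong xs (λ f → sumℚ-*ˡ a (λ c → u (update f x c)) allContents) g)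
        (sumTiles-*ˡ xs a (sumTile x u) g)

-- Prepending a particle to a word

zeros-particle∷ : ∀ s w → isP s ≡ true → zeros (s ∷ w) ≡ zeros w
zeros-particle∷ ○ w refl = refl
zeros-particle∷ ● w refl = refl

zeros≤length : ∀ w → zeros w ≤ length w
zeros≤length = List.length-filter (T? ∘ isZero)

2r+[M∸r]≡M+r : ∀ {r M} → r ≤ M → 2 ℕ.* r ℕ.+ (M ∸ r) ≡ M ℕ.+ r
2r+[M∸r]≡M+r {r} {M} r≤M = begin
  (r ℕ.+ (r ℕ.+ 0)) ℕ.+ (M ∸ r) ≡⟨ cong (λ k → r ℕ.+ k ℕ.+ (M ∸ r)) (ℕₚ.+-identityʳ r) ⟩
  r ℕ.+ r ℕ.+ (M ∸ r)           ≡⟨ ℕₚ.+-assoc r r (M ∸ r) ⟩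
  r ℕ.+ (r ℕ.+ (M ∸ r))         ≡⟨ cong (r ℕ.+_) (ℕₚ.m+[n∸m]≡n r≤M) ⟩
  r ℕ.+ M                       ≡⟨ ℕₚ.+-comm r M ⟩
  M ℕ.+ r                       ∎

shift : Tile → Tile
shift (p , q) = (suc p , suc q)

-- tiles w is definitionally concatMap (column w) (upTo (length w)).
column : List Sign → ℕ → List Tile
column w q = concatMap (λ p → if isP (at w p) ∨ isP (at w q) then (p , q) ∷ [] else []) (upTo (suc q))

column-proj₂≡ : ∀ w q → All (λ y → proj₂ y ≡ q) (column w q)
column-proj₂≡ w q = All.concat⁺ (All.map⁺ (All.applyUpTo⁺₂ _ (suc q) single))
  where
  single : ∀ p → All (λ y → proj₂ y ≡ q) (if isP (at w p) ∨ isP (at w q) then (p , q) ∷ [] else [])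
  single p with isP (at w p) ∨ isP (at w q)
  ... | true  = refl ∷ []
  ... | false = []

paddedColumns : List Sign → List ℕ → List Tile
paddedColumns w = concatMap (λ q → (0 , suc q) ∷ map shift (column w q))

column-∷ : ∀ s w → isP s ≡ true → ∀ q → column (s ∷ w) (suc q) ≡ (0 , suc q) ∷ map shift (column w q)
column-∷ s w s-particle q rewrite s-particle = cong ((0 , suc q) ∷_) (begin
    concatMap K (applyUpTo suc (suc q))
      ≡⟨ cong (concatMap K) (sym (List.map-applyUpTo (λ p → p) suc (suc q))) ⟩
    concatMap K (map suc (upTo (suc q)))
      ≡⟨ List.concatMap-map K suc (upTo (suc q)) ⟩
    concatMap (K ∘ suc) (upTo (suc q))
      ≡⟨ List.concatMap-cong (λ p → shift-if (isP (at w p) ∨ isP (at w q)) (p , q)) (upTo (suc q)) ⟩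
    concatMap (map shift ∘ K′) (upTo (suc q))
      ≡⟨ List.map-concatMap shift K′ (upTo (suc q)) ⟨
    map shift (column w q) ∎)
  where
  K : ℕ → List Tile
  K p = if isP (at (s ∷ w) p) ∨ isP (at w q) then (p , suc q) ∷ [] else []
  K′ : ℕ → List Tile
  K′ p = if isP (at w p) ∨ isP (at w q) then (p , q) ∷ [] else []
  shift-if : ∀ b y → (if b then shift y ∷ [] else []) ≡ map shift (if b then y ∷ [] else [])
  shift-if true  y = refl
  shift-if false y = refl

tiles-∷ : ∀ s w → isP s ≡ true → tiles (s ∷ w) ≡ (0 , 0) ∷ paddedColumns w (upTo (length w))
tiles-∷ s w s-particle = cong₂ _++_ corner (begin
    concatMap (column (s ∷ w)) (applyUpTo suc (length w))
      ≡⟨ cong (concatMap (column (s ∷ w))) (sym (List.map-applyUpTo (λ q → q) suc (length w))) ⟩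
    concatMap (column (s ∷ w)) (map suc (upTo (length w)))
      ≡⟨ List.concatMap-map (column (s ∷ w)) suc (upTo (length w)) ⟩
    concatMap (column (s ∷ w) ∘ suc) (upTo (length w))
      ≡⟨ List.concatMap-cong (column-∷ s w s-particle) (upTo (length w)) ⟩
    paddedColumns w (upTo (length w)) ∎)
  where
  corner : column (s ∷ w) 0 ≡ (0 , 0) ∷ []
  corner rewrite s-particle = refl

map-suc-shift : ∀ {f g : ℕ → Tile} → (∀ n → f (suc n) ≡ shift (g n)) →
  ∀ ns → map f (map suc ns) ≡ map shift (map g ns)
map-suc-shift e ns = trans (sym (List.map-∘ ns)) (trans (List.map-cong e ns) (List.map-∘ ns))

westStrip-suc : ∀ s w p → westStrip (s ∷ w) (suc p) ≡ map shift (westStrip w p)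
westStrip-suc s w p = begin
    map (λ q → (suc p , q)) (filterᵇ (suc p ≤ᵇ_) (applyUpTo suc (length w)))
      ≡⟨ cong (map (λ q → (suc p , q)) ∘ filterᵇ (suc p ≤ᵇ_)) (sym (List.map-applyUpTo (λ q → q) suc (length w))) ⟩
    map (λ q → (suc p , q)) (filterᵇ (suc p ≤ᵇ_) (map suc (upTo (length w))))
      ≡⟨ cong (map (λ q → (suc p , q))) (filterᵇ-map suc (≤ᵇ-suc p) (upTo (length w))) ⟩
    map (λ q → (suc p , q)) (map suc (filterᵇ (p ≤ᵇ_) (upTo (length w))))
      ≡⟨ map-suc-shift (λ _ → refl) _ ⟩
    map shift (westStrip w p) ∎
  where
  ≤ᵇ-suc : ∀ p q → (suc p ≤ᵇ suc q) ≡ (p ≤ᵇ q)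
  ≤ᵇ-suc zero    q = refl
  ≤ᵇ-suc (suc p) q = refl

westStrip-zero : ∀ s w → westStrip (s ∷ w) 0 ≡ (0 , 0) ∷ map (λ q → (0 , suc q)) (upTo (length w))
westStrip-zero s w = cong ((0 , 0) ∷_) (begin
    map (λ q → (0 , q)) (filterᵇ (0 ≤ᵇ_) (applyUpTo suc (length w)))
      ≡⟨ cong (map (λ q → (0 , q))) (List.filter-all (T? ∘ (0 ≤ᵇ_)) (All.applyUpTo⁺₂ suc (length w) _)) ⟩
    map (λ q → (0 , q)) (applyUpTo suc (length w))
      ≡⟨ List.map-applyUpTo suc (λ q → (0 , q)) (length w) ⟩
    applyUpTo (λ q → (0 , suc q)) (length w)
      ≡⟨ List.map-applyUpTo (λ q → q) (λ q → (0 , suc q)) (length w) ⟨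
    map (λ q → (0 , suc q)) (upTo (length w)) ∎)

northSquares northRhombi : List Sign → ℕ → List Tile
northSquares w q = map (λ p → (p , q)) (filterᵇ (isP ∘ at w) (downFrom (suc q)))
northRhombi  w q = map (λ p → (p , q)) (filterᵇ (isZero ∘ at w) (downFrom q))

northStrip-∷ : ∀ s w → isP s ≡ true → ∀ q →
  northStrip (s ∷ w) (suc q) ≡ map shift (northSquares w q) ++ (0 , suc q) ∷ map shift (northRhombi w q)
northStrip-∷ s w s-particle q = begin
    northPart isP (suc (suc q)) ++ northPart isZero (suc q)
      ≡⟨ cong₂ _++_ (northPart-suc isP (suc q)) (northPart-suc isZero q) ⟩
    (map shift (northSquares w q) ++ lastTile isP) ++ map shift (northRhombi w q) ++ lastTile isZero
      ≡⟨ cong₂ (λ xs ys → (map shift (northSquares w q) ++ xs) ++ map shift (northRhombi w q) ++ ys)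
               lastTile-square lastTile-rhombus ⟩
    (map shift (northSquares w q) ++ (0 , suc q) ∷ []) ++ map shift (northRhombi w q) ++ []
      ≡⟨ cong ((map shift (northSquares w q) ++ (0 , suc q) ∷ []) ++_) (List.++-identityʳ (map shift (northRhombi w q))) ⟩
    (map shift (northSquares w q) ++ (0 , suc q) ∷ []) ++ map shift (northRhombi w q)
      ≡⟨ List.++-assoc (map shift (northSquares w q)) ((0 , suc q) ∷ []) (map shift (northRhombi w q)) ⟩
    map shift (northSquares w q) ++ (0 , suc q) ∷ map shift (northRhombi w q) ∎
  where
  northPart : (Sign → Bool) → ℕ → List Tile
  northPart P n = map (λ p → (p , suc q)) (filterᵇ (P ∘ at (s ∷ w)) (downFrom n))
  lastTile : (Sign → Bool) → List Tile
  lastTile P = map (λ p → (p , suc q)) (filterᵇ (P ∘ at (s ∷ w)) (0 ∷ []))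
  northPart-suc : ∀ P n →
    northPart P (suc n) ≡ map shift (map (λ p → (p , q)) (filterᵇ (P ∘ at w) (downFrom n))) ++ lastTile P
  northPart-suc P n = begin
      map (λ p → (p , suc q)) (filterᵇ (P ∘ at (s ∷ w)) (downFrom (suc n)))
        ≡⟨ cong (map (λ p → (p , suc q)) ∘ filterᵇ (P ∘ at (s ∷ w))) (downFrom-suc n) ⟩
      map (λ p → (p , suc q)) (filterᵇ (P ∘ at (s ∷ w)) (map suc (downFrom n) ++ 0 ∷ []))
        ≡⟨ cong (map (λ p → (p , suc q))) (List.filter-++ (T? ∘ P ∘ at (s ∷ w)) (map suc (downFrom n)) (0 ∷ [])) ⟩
      map (λ p → (p , suc q)) (filterᵇ (P ∘ at (s ∷ w)) (map suc (downFrom n)) ++ filterᵇ (P ∘ at (s ∷ w)) (0 ∷ []))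
        ≡⟨ List.map-++ (λ p → (p , suc q))
                       (filterᵇ (P ∘ at (s ∷ w)) (map suc (downFrom n))) (filterᵇ (P ∘ at (s ∷ w)) (0 ∷ [])) ⟩
      map (λ p → (p , suc q)) (filterᵇ (P ∘ at (s ∷ w)) (map suc (downFrom n))) ++ lastTile P
        ≡⟨ cong (λ xs → map (λ p → (p , suc q)) xs ++ lastTile P) (filterᵇ-map suc (λ _ → refl) (downFrom n)) ⟩
      map (λ p → (p , suc q)) (map suc (filterᵇ (P ∘ at w) (downFrom n))) ++ lastTile P
        ≡⟨ cong (_++ lastTile P) (map-suc-shift (λ _ → refl) _) ⟩
      map shift (map (λ p → (p , q)) (filterᵇ (P ∘ at w) (downFrom n))) ++ lastTile P ∎
  lastTile-square : lastTile isP ≡ (0 , suc q) ∷ []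
  lastTile-square rewrite s-particle = refl
  lastTile-rhombus : lastTile isZero ≡ []
  lastTile-rhombus rewrite s-particle = refl

topRowEmpty : List ℕ → Filling → Bool
topRowEmpty Q f = allᵇ (λ q → isEmpty (f (0 , suc q))) Q

whenTopRowEmpty : List ℕ → (Filling → ℚ) → Filling → ℚ
whenTopRowEmpty Q h f = if topRowEmpty Q f then h (f ∘ shift) else 0ℚ

-- A shifted tile is never in the top row, so summing over it commutes with the top-row test.
sumTiles-shift : ∀ Q ys h g →
  sumTiles (map shift ys) (whenTopRowEmpty Q h) g ≡ whenTopRowEmpty Q (sumTiles ys h) g
sumTiles-shift Q []       h g = refl
sumTiles-shift Q (y ∷ ys) h g =
  trans (sumTiles-cong (map shift ys) sumTile-shift g) (sumTiles-shift Q ys (sumTile y h) g)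
  where
  sumTile-shift : ∀ f → sumTile (shift y) (whenTopRowEmpty Q h) f ≡ whenTopRowEmpty Q (sumTile y h) f
  sumTile-shift f with topRowEmpty Q f
  ... | true  = refl
  ... | false = refl

topRowEmpty-update : ∀ {q Q} f c → All (q ≢_) Q → topRowEmpty Q (update f (0 , suc q) c) ≡ topRowEmpty Q f
topRowEmpty-update f c []                  = refl
topRowEmpty-update {q} f c (_∷_ {q′} q≢q′ q∉Q) rewrite ≢⇒≡ᵇ-false (q≢q′ ∘ sym) =
  cong (isEmpty (f (0 , suc q′)) ∧_) (topRowEmpty-update f c q∉Q)

sumTiles-paddedColumns : ∀ w {Q} → Unique Q → ∀ h g →
  sumTiles (paddedColumns w Q) (whenTopRowEmpty Q h) g ≡ sumTiles (concatMap (column w) Q) h (g ∘ shift)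
sumTiles-paddedColumns w []                       h g = refl
sumTiles-paddedColumns w {q ∷ Q} (q∉Q ∷ unique-Q) h g = begin
    sumTiles (((0 , suc q) ∷ map shift (column w q)) ++ paddedColumns w Q) (whenTopRowEmpty (q ∷ Q) h) g
      ≡⟨ cong (λ k → k g) (sumTiles-++ ((0 , suc q) ∷ map shift (column w q)) (paddedColumns w Q) (whenTopRowEmpty (q ∷ Q) h)) ⟩
    sumTiles (paddedColumns w Q) (sumTiles (map shift (column w q)) (sumTile (0 , suc q) (whenTopRowEmpty (q ∷ Q) h))) g
      ≡⟨ sumTiles-cong (paddedColumns w Q) (λ f → trans (sumTiles-cong (map shift (column w q)) sumTile-topRow f)
                                                         (sumTiles-shift Q (column w q) h f)) g ⟩
    sumTiles (paddedColumns w Q) (whenTopRowEmpty Q (sumTiles (column w q) h)) g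
      ≡⟨ sumTiles-paddedColumns w unique-Q (sumTiles (column w q) h) g ⟩
    sumTiles (concatMap (column w) Q) (sumTiles (column w q) h) (g ∘ shift)
      ≡⟨ cong (λ k → k (g ∘ shift)) (sumTiles-++ (column w q) (concatMap (column w) Q) h) ⟨
    sumTiles (concatMap (column w) (q ∷ Q)) h (g ∘ shift) ∎
  where
  sumTile-topRow : ∀ f → sumTile (0 , suc q) (whenTopRowEmpty (q ∷ Q) h) f ≡ whenTopRowEmpty Q h f
  sumTile-topRow f rewrite ≡ᵇ-refl q | topRowEmpty-update f nothing q∉Q = ℚₚ.+-identityʳ _

cornerWestStrip-allEmpty : ∀ s w f c →
  allᵇ (isEmpty ∘ update f (0 , 0) c) (after (0 , 0) (westStrip (s ∷ w) 0)) ≡ topRowEmpty (upTo (length w)) f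
cornerWestStrip-allEmpty s w f c =
  trans (cong (allᵇ (isEmpty ∘ update f (0 , 0) c) ∘ after (0 , 0)) (westStrip-zero s w))
        (allᵇ-map (isEmpty ∘ update f (0 , 0) c) (λ k → (0 , suc k)) (upTo (length w)))

topRowEmpty⇒All : ∀ Q f → topRowEmpty Q f ≡ true → All (λ q → f (0 , suc q) ≡ nothing) Q
topRowEmpty⇒All []      f _ = []
topRowEmpty⇒All (q ∷ Q) f e with isEmpty (f (0 , suc q)) in eq
... | true = isEmpty⇒≡nothing eq ∷ topRowEmpty⇒All Q f e

data Padded (g : Filling) : List Tile → List Tile → Set where
  []   : Padded g [] []
  keep : ∀ {l l′} y → Padded g l l′ → Padded g (y ∷ l) (shift y ∷ l′)
  pad  : ∀ {l l′} q → g (0 , suc q) ≡ nothing → Padded g l l′ → Padded g l ((0 , suc q) ∷ l′)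

module _ {g : Filling} where

  Padded-++ : ∀ {l₁ l₁′ l₂ l₂′} → Padded g l₁ l₁′ → Padded g l₂ l₂′ → Padded g (l₁ ++ l₂) (l₁′ ++ l₂′)
  Padded-++ []            r = r
  Padded-++ (keep y i)    r = keep y (Padded-++ i r)
  Padded-++ (pad q e i)   r = pad q e (Padded-++ i r)

  Padded-shift : ∀ l → Padded g l (map shift l)
  Padded-shift []      = []
  Padded-shift (y ∷ l) = keep y (Padded-shift l)

  Padded-reverse : ∀ {l l′} → Padded g l l′ → Padded g (reverse l) (reverse l′)
  Padded-reverse [] = []
  Padded-reverse {y ∷ l} {_ ∷ l′} (keep y i)
    rewrite List.unfold-reverse y l | List.unfold-reverse (shift y) l′ =
    Padded-++ (Padded-reverse i) (keep y [])
  Padded-reverse {l} {_ ∷ l′} (pad q e i)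
    rewrite List.unfold-reverse (0 , suc q) l′ =
    subst (λ k → Padded g k _) (List.++-identityʳ (reverse l)) (Padded-++ (Padded-reverse i) (pad q e []))

  Padded-before : ∀ y {l l′} → Padded g l l′ → Padded g (before y l) (before (shift y) l′)
  Padded-before y [] = []
  Padded-before y (keep y′ i) with y′ ==T y
  ... | true  = []
  ... | false = keep y′ (Padded-before y i)
  Padded-before y (pad q e i) = pad q e (Padded-before y i)

  Padded-after : ∀ y {l l′} → Padded g l l′ → Padded g (after y l) (after (shift y) l′)
  Padded-after y [] = []
  Padded-after y (keep y′ i) with y′ ==T y
  ... | true  = i
  ... | false = Padded-after y i
  Padded-after y (pad q e i) = Padded-after y i

  Padded-firstNonEmpty : ∀ {l l′} → Padded g l l′ → firstNonEmpty g l′ ≡ firstNonEmpty (g ∘ shift) l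
  Padded-firstNonEmpty [] = refl
  Padded-firstNonEmpty (keep y i) with g (shift y)
  ... | nothing = Padded-firstNonEmpty i
  ... | just ℓ  = refl
  Padded-firstNonEmpty (pad q e i) with g (0 , suc q) | e
  ... | nothing | refl = Padded-firstNonEmpty i

  Padded-allEmpty : ∀ {l l′} → Padded g l l′ → allᵇ (isEmpty ∘ g) l′ ≡ allᵇ (isEmpty ∘ g ∘ shift) l
  Padded-allEmpty []          = refl
  Padded-allEmpty (keep y i)  = cong (isEmpty (g (shift y)) ∧_) (Padded-allEmpty i)
  Padded-allEmpty (pad q e i) rewrite e = Padded-allEmpty i

module _ (s : Sign) (w : List Sign) (s-particle : isP s ≡ true) {g : Filling} where

  westStrip-padded : ∀ p → Padded g (westStrip w p) (westStrip (s ∷ w) (suc p))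
  westStrip-padded p = subst (Padded g _) (sym (westStrip-suc s w p)) (Padded-shift (westStrip w p))

  northStrip-padded : ∀ q → g (0 , suc q) ≡ nothing → Padded g (northStrip w q) (northStrip (s ∷ w) (suc q))
  northStrip-padded q e = subst (Padded g _) (sym (northStrip-∷ s w s-particle q))
    (Padded-++ (Padded-shift (northSquares w q)) (pad q e (Padded-shift (northRhombi w q))))

  seesRight-shift : ∀ p q → seesRight (s ∷ w) g (suc p , suc q) ≡ seesRight w (g ∘ shift) (p , q)
  seesRight-shift p q = Padded-firstNonEmpty (Padded-reverse (Padded-before (p , q) (westStrip-padded p)))

  seesBelow-shift : ∀ p q → g (0 , suc q) ≡ nothing → seesBelow (s ∷ w) g (suc p , suc q) ≡ seesBelow w (g ∘ shift) (p , q)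
  seesBelow-shift p q e = Padded-firstNonEmpty (Padded-reverse (Padded-before (p , q) (northStrip-padded q e)))

  westAfter-shift : ∀ p q → allᵇ (isEmpty ∘ g) (after (suc p , suc q) (westStrip (s ∷ w) (suc p)))
                          ≡ allᵇ (isEmpty ∘ g ∘ shift) (after (p , q) (westStrip w p))
  westAfter-shift p q = Padded-allEmpty (Padded-after (p , q) (westStrip-padded p))

  northAfter-shift : ∀ p q → g (0 , suc q) ≡ nothing →
    allᵇ (isEmpty ∘ g) (after (suc p , suc q) (northStrip (s ∷ w) (suc q)))
      ≡ allᵇ (isEmpty ∘ g ∘ shift) (after (p , q) (northStrip w q))
  northAfter-shift p q e = Padded-allEmpty (Padded-after (p , q) (northStrip-padded q e))

-- Tableau weights

module WeightsAt (A B G D T : ℚ) where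

  letterWt : Letter → Kind → ℚ
  letterWt α hrh = A *ℚ T
  letterWt β vrh = B *ℚ T
  letterWt ℓ k   = letterVal A B G D ℓ *ℚ 1ℚ

  localWt : Content → Kind → Content → Content → ℚ
  localWt (just ℓ) k      r b = letterWt ℓ k
  localWt nothing  square r b = tIf T (isαγ r ∧ isαδ b) *ℚ tIf T (isβ r)
  localWt nothing  vrh    r b = tIf (T *ℚ T) (isβ r) *ℚ tIf T (isαγ r)
  localWt nothing  hrh    r b = tIf (T *ℚ T) (isα b) *ℚ tIf T (isβδ b)

  tileWt-local : ∀ μ f x → tileWt A B G D T μ f x ≡ localWt (f x) (kind μ x) (seesRight μ f x) (seesBelow μ f x)
  tileWt-local μ f x with f x | kind μ x
  ... | just α  | square = refl
  ... | just α  | hrh    = refl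
  ... | just α  | vrh    = refl
  ... | just β  | square = refl
  ... | just β  | hrh    = refl
  ... | just β  | vrh    = refl
  ... | just γ  | _      = refl
  ... | just δ  | _      = refl
  ... | nothing | square = refl
  ... | nothing | hrh    = refl
  ... | nothing | vrh    = refl

  tableauWt : List Sign → Filling → ℚ
  tableauWt μ f = if isTableau μ f then wt A B G D T μ f else 0ℚ

  R≡sumTiles : ∀ μ → R A B G D T μ ≡ sumTiles (tiles μ) (tableauWt μ) emptyFilling
  R≡sumTiles μ = trans (sumℚ-filterᵇ (wt A B G D T μ) (isTableau μ) (fillings (tiles μ))) (sum-fillings (tiles μ) (tableauWt μ))

  tableauWt-∷ : ∀ s w → isP s ≡ true → ∀ g → tableauWt (s ∷ w) g ≡
    (if validTile (s ∷ w) g (0 , 0) ∧ allᵇ (validTile (s ∷ w) g) (paddedColumns w (upTo (length w)))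
     then tileWt A B G D T (s ∷ w) g (0 , 0) *ℚ prodℚ (map (tileWt A B G D T (s ∷ w) g) (paddedColumns w (upTo (length w))))
     else 0ℚ)
  tableauWt-∷ s w s-particle g rewrite tiles-∷ s w s-particle = refl

  -- the weight of an empty top-row tile that sees ℓ to its right; b is isP of the letter of its column
  rowWt : Letter → Bool → ℚ
  rowWt ℓ b = localWt nothing (kindB true b) (just ℓ) nothing

  localWt-seesβδ : ∀ ℓ → isβδ (just ℓ) ≡ true → ∀ b c → localWt nothing (kindB true b) (just ℓ) c ≡ rowWt ℓ b
  localWt-seesβδ β _ true  c = refl
  localWt-seesβδ β _ false c = refl
  localWt-seesβδ δ _ true  c = refl
  localWt-seesβδ δ _ false c = refl

  localWt-similar : ∀ c k {r r′} → SameUpToαγ r r′ → ∀ b → localWt c k r b ≡ localWt c k r′ b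
  localWt-similar c        k      same b = refl
  localWt-similar (just ℓ) k      αγ   b = refl
  localWt-similar nothing  square αγ   b = refl
  localWt-similar nothing  hrh    αγ   b = refl
  localWt-similar nothing  vrh    αγ   b = refl

  rowWts : Letter → List Sign → ℚ
  rowWts ℓ w = prodℚ (map (rowWt ℓ ∘ isP) w)

  module _ (s : Sign) (w : List Sign) (s-particle : isP s ≡ true) (g : Filling) where

    validTile-shift : ∀ p q → g (0 , suc q) ≡ nothing → validTile (s ∷ w) g (suc p , suc q) ≡ validTile w (g ∘ shift) (p , q)
    validTile-shift p q e =
      cong₂ (validTileOf (if p ≡ᵇ q then borderOK (at w p) c else true) (kind w (p , q)) c)
            (northAfter-shift s w s-particle p q e) (westAfter-shift s w s-particle p q)
      where c = g (suc p , suc q)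

    tileWt-shift : ∀ p q → g (0 , suc q) ≡ nothing → tileWt A B G D T (s ∷ w) g (suc p , suc q) ≡ tileWt A B G D T w (g ∘ shift) (p , q)
    tileWt-shift p q e =
      trans (tileWt-local (s ∷ w) g (suc p , suc q))
            (trans (cong₂ (localWt (g (suc p , suc q)) (kind w (p , q)))
                          (seesRight-shift s w s-particle p q) (seesBelow-shift s w s-particle p q e))
                   (sym (tileWt-local w (g ∘ shift) (p , q))))

    validTile-topRow : ∀ q → g (0 , suc q) ≡ nothing → validTile (s ∷ w) g (0 , suc q) ≡ true
    validTile-topRow q e rewrite e = kindOK-nothing (kind (s ∷ w) (0 , suc q))
      where
      kindOK-nothing : ∀ k → kindOK k nothing ∧ true ∧ true ≡ true
      kindOK-nothing square = refl
      kindOK-nothing hrh    = refl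
      kindOK-nothing vrh    = refl

    seesRight-topRow : ∀ {ℓ} q → g (0 , 0) ≡ just ℓ → All (λ k → g (0 , suc k) ≡ nothing) (upTo (length w)) →
      seesRight (s ∷ w) g (0 , suc q) ≡ just ℓ
    seesRight-topRow {ℓ} q corner row-empty = begin
        firstNonEmpty g (reverse (before (0 , suc q) (westStrip (s ∷ w) 0)))
          ≡⟨ cong (firstNonEmpty g ∘ reverse ∘ before (0 , suc q)) (westStrip-zero s w) ⟩
        firstNonEmpty g (reverse ((0 , 0) ∷ before (0 , suc q) row))
          ≡⟨ cong (firstNonEmpty g) (List.unfold-reverse (0 , 0) (before (0 , suc q) row)) ⟩
        firstNonEmpty g (reverse (before (0 , suc q) row) ++ (0 , 0) ∷ [])
          ≡⟨ firstNonEmpty-skip g ((0 , 0) ∷ []) (All-resp-↭ (↭-sym (↭-reverse _)) (All-before (0 , suc q) (All.map⁺ row-empty))) ⟩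
        firstNonEmpty g ((0 , 0) ∷ [])
          ≡⟨ firstNonEmpty-corner ⟩
        just ℓ ∎
      where
      row = map (λ k → (0 , suc k)) (upTo (length w))
      firstNonEmpty-corner : firstNonEmpty g ((0 , 0) ∷ []) ≡ just ℓ
      firstNonEmpty-corner rewrite corner = refl

    topRow-paddedColumns-valid : All (λ q → g (0 , suc q) ≡ nothing) (upTo (length w)) →
      allᵇ (validTile (s ∷ w) g) (paddedColumns w (upTo (length w))) ≡ isTableau w (g ∘ shift)
    topRow-paddedColumns-valid row-empty =
      trans (allᵇ-concatMap (validTile (s ∷ w) g) _ (upTo (length w)))
            (trans (allᵇ-cong-local (All.map (λ {q} → paddedColumn-valid q) row-empty))
                   (sym (allᵇ-concatMap (validTile w (g ∘ shift)) (column w) (upTo (length w)))))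
      where
      paddedColumn-valid : ∀ q → g (0 , suc q) ≡ nothing →
        allᵇ (validTile (s ∷ w) g) ((0 , suc q) ∷ map shift (column w q)) ≡ allᵇ (validTile w (g ∘ shift)) (column w q)
      paddedColumn-valid q e rewrite validTile-topRow q e =
        trans (allᵇ-map (validTile (s ∷ w) g) shift (column w q))
              (allᵇ-cong-local (All.map (λ { {p , _} refl → validTile-shift p q e }) (column-proj₂≡ w q)))

    topRow-paddedColumns-wt : ∀ {ℓ} → isβδ (just ℓ) ≡ true → g (0 , 0) ≡ just ℓ →
      All (λ q → g (0 , suc q) ≡ nothing) (upTo (length w)) →
      prodℚ (map (tileWt A B G D T (s ∷ w) g) (paddedColumns w (upTo (length w)))) ≡ rowWts ℓ w *ℚ wt A B G D T w (g ∘ shift)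
    topRow-paddedColumns-wt {ℓ} ℓ-βδ corner row-empty = begin
        prodℚ (map tW (paddedColumns w (upTo M)))
          ≡⟨ prodℚ-concatMap tW _ (upTo M) ⟩
        prodℚ (map (λ q → prodℚ (map tW ((0 , suc q) ∷ map shift (column w q)))) (upTo M))
          ≡⟨ prodℚ-cong-local (All.map (λ {q} → paddedColumn-wt q) row-empty) ⟩
        prodℚ (map (λ q → rowWt ℓ (isP (at w q)) *ℚ prodℚ (map tW′ (column w q))) (upTo M))
          ≡⟨ prodℚ-* (λ q → rowWt ℓ (isP (at w q))) (λ q → prodℚ (map tW′ (column w q))) (upTo M) ⟩
        prodℚ (map (λ q → rowWt ℓ (isP (at w q))) (upTo M)) *ℚ prodℚ (map (λ q → prodℚ (map tW′ (column w q))) (upTo M))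
          ≡⟨ cong₂ _*ℚ_ rowWts-at (sym (prodℚ-concatMap tW′ (column w) (upTo M))) ⟩
        rowWts ℓ w *ℚ wt A B G D T w (g ∘ shift) ∎
      where
      M = length w
      tW = tileWt A B G D T (s ∷ w) g
      tW′ = tileWt A B G D T w (g ∘ shift)
      topRow-wt : ∀ q → g (0 , suc q) ≡ nothing → tW (0 , suc q) ≡ rowWt ℓ (isP (at w q))
      topRow-wt q e = begin
          tW (0 , suc q)
            ≡⟨ tileWt-local (s ∷ w) g (0 , suc q) ⟩
          localWt (g (0 , suc q)) (kindB (isP s) b) (seesRight (s ∷ w) g (0 , suc q)) sb
            ≡⟨ cong₂ (λ c r → localWt c (kindB (isP s) b) r sb) e (seesRight-topRow q corner row-empty) ⟩
          localWt nothing (kindB (isP s) b) (just ℓ) sb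
            ≡⟨ cong (λ p → localWt nothing (kindB p b) (just ℓ) sb) s-particle ⟩
          localWt nothing (kindB true b) (just ℓ) sb
            ≡⟨ localWt-seesβδ ℓ ℓ-βδ b sb ⟩
          rowWt ℓ b ∎
        where
        b = isP (at w q)
        sb = seesBelow (s ∷ w) g (0 , suc q)
      paddedColumn-wt : ∀ q → g (0 , suc q) ≡ nothing →
        prodℚ (map tW ((0 , suc q) ∷ map shift (column w q))) ≡ rowWt ℓ (isP (at w q)) *ℚ prodℚ (map tW′ (column w q))
      paddedColumn-wt q e =
        cong₂ _*ℚ_ (topRow-wt q e)
              (trans (cong prodℚ (sym (List.map-∘ (column w q))))
                     (prodℚ-cong-local (All.map (λ { {p , _} refl → tileWt-shift p q e }) (column-proj₂≡ w q))))
      rowWts-at : prodℚ (map (λ q → rowWt ℓ (isP (at w q))) (upTo M)) ≡ rowWts ℓ w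
      rowWts-at = cong prodℚ (trans (List.map-∘ (upTo M))
                                    (cong (map (rowWt ℓ ∘ isP)) (trans (List.map-applyUpTo (λ q → q) (at w) M) (applyUpTo-at w))))

  tableauWt-corner-βδ : ∀ s w → isP s ≡ true → ∀ ℓ → isβδ (just ℓ) ≡ true → ∀ f → let g = update f (0 , 0) (just ℓ) in
    validTile (s ∷ w) g (0 , 0) ≡ topRowEmpty (upTo (length w)) f →
    tableauWt (s ∷ w) g ≡ (tileWt A B G D T (s ∷ w) g (0 , 0) *ℚ rowWts ℓ w) *ℚ whenTopRowEmpty (upTo (length w)) (tableauWt w) f
  tableauWt-corner-βδ s w s-particle ℓ ℓ-βδ f corner-valid
    rewrite tableauWt-∷ s w s-particle (update f (0 , 0) (just ℓ)) | corner-valid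
    with topRowEmpty (upTo (length w)) f in row-empty
  ... | false = sym (ℚₚ.*-zeroʳ (tileWt A B G D T (s ∷ w) (update f (0 , 0) (just ℓ)) (0 , 0) *ℚ rowWts ℓ w))
  ... | true
    rewrite topRow-paddedColumns-valid s w s-particle (update f (0 , 0) (just ℓ)) (topRowEmpty⇒All _ f row-empty)
          | topRow-paddedColumns-wt s w s-particle (update f (0 , 0) (just ℓ)) ℓ-βδ refl (topRowEmpty⇒All _ f row-empty)
    with isTableau w (f ∘ shift)
  ... | true  = sym (ℚₚ.*-assoc (tileWt A B G D T (s ∷ w) (update f (0 , 0) (just ℓ)) (0 , 0)) (rowWts ℓ w) _)
  ... | false = sym (ℚₚ.*-zeroʳ (tileWt A B G D T (s ∷ w) (update f (0 , 0) (just ℓ)) (0 , 0) *ℚ rowWts ℓ w))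

  module _ (w : List Sign) (f : Filling) where
    private
      gα gγ : Filling
      gα = update f (0 , 0) (just α)
      gγ = update f (0 , 0) (just γ)

      similar : ∀ y → SameUpToαγ (gα y) (gγ y)
      similar y with y ==T (0 , 0)
      ... | true  = αγ
      ... | false = same

      content-αγ : ∀ p q → gα (p , suc q) ≡ gγ (p , suc q)
      content-αγ zero    q = refl
      content-αγ (suc p) q = refl

      kind-αγ : ∀ p q → kind (● ∷ w) (p , suc q) ≡ kind (○ ∷ w) (p , suc q)
      kind-αγ zero    q = refl
      kind-αγ (suc p) q = refl

      northStrip-αγ : ∀ q → northStrip (● ∷ w) (suc q) ≡ northStrip (○ ∷ w) (suc q)
      northStrip-αγ q = trans (northStrip-∷ ● w refl q) (sym (northStrip-∷ ○ w refl q))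

      northStrip-avoids-corner : ∀ q → All (λ y → gα y ≡ gγ y) (northStrip (○ ∷ w) (suc q))
      northStrip-avoids-corner q = subst (All (λ y → gα y ≡ gγ y)) (sym (northStrip-∷ ○ w refl q))
        (All.++⁺ (All.map⁺ (All.universal (λ _ → refl) (northSquares w q)))
                 (refl ∷ All.map⁺ (All.universal (λ _ → refl) (northRhombi w q))))

      north-αγ : ∀ y q → allᵇ (isEmpty ∘ gα) (after y (northStrip (● ∷ w) (suc q)))
                       ≡ allᵇ (isEmpty ∘ gγ) (after y (northStrip (○ ∷ w) (suc q)))
      north-αγ y q rewrite northStrip-αγ q = allᵇ-cong (isEmpty-similar ∘ similar) (after y (northStrip (○ ∷ w) (suc q)))

      west-αγ : ∀ y p → allᵇ (isEmpty ∘ gα) (after y (westStrip (● ∷ w) p))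
                      ≡ allᵇ (isEmpty ∘ gγ) (after y (westStrip (○ ∷ w) p))
      west-αγ y p = allᵇ-cong (isEmpty-similar ∘ similar) (after y (westStrip (○ ∷ w) p))

      validTile-αγ : ∀ p q → validTile (● ∷ w) gα (p , suc q) ≡ validTile (○ ∷ w) gγ (p , suc q)
      validTile-αγ zero    q =
        cong₂ (validTileOf true (kind (○ ∷ w) (0 , suc q)) (f (0 , suc q))) (north-αγ (0 , suc q) q) (west-αγ (0 , suc q) 0)
      validTile-αγ (suc p) q =
        cong₂ (validTileOf (if p ≡ᵇ q then borderOK (at w p) c else true) (kind w (p , q)) c)
              (north-αγ (suc p , suc q) q) (west-αγ (suc p , suc q) (suc p))
        where c = f (suc p , suc q)

      tileWt-αγ : ∀ p q → tileWt A B G D T (● ∷ w) gα (p , suc q) ≡ tileWt A B G D T (○ ∷ w) gγ (p , suc q)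
      tileWt-αγ p q = begin
          tileWt A B G D T (● ∷ w) gα (p , suc q)
            ≡⟨ tileWt-local (● ∷ w) gα (p , suc q) ⟩
          localWt (gα (p , suc q)) (kind (● ∷ w) (p , suc q)) (seesRight (● ∷ w) gα (p , suc q)) sb
            ≡⟨ cong₂ (λ c k → localWt c k (seesRight (● ∷ w) gα (p , suc q)) sb) (content-αγ p q) (kind-αγ p q) ⟩
          localWt c (kind (○ ∷ w) (p , suc q)) (seesRight (● ∷ w) gα (p , suc q)) sb
            ≡⟨ localWt-similar c (kind (○ ∷ w) (p , suc q))
                 (firstNonEmpty-similar similar (reverse (before (p , suc q) (westStrip (○ ∷ w) p)))) sb ⟩
          localWt c (kind (○ ∷ w) (p , suc q)) (seesRight (○ ∷ w) gγ (p , suc q)) sb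
            ≡⟨ cong (localWt c (kind (○ ∷ w) (p , suc q)) (seesRight (○ ∷ w) gγ (p , suc q))) seesBelow-αγ ⟩
          localWt c (kind (○ ∷ w) (p , suc q)) (seesRight (○ ∷ w) gγ (p , suc q)) (seesBelow (○ ∷ w) gγ (p , suc q))
            ≡⟨ tileWt-local (○ ∷ w) gγ (p , suc q) ⟨
          tileWt A B G D T (○ ∷ w) gγ (p , suc q) ∎
        where
        c = gγ (p , suc q)
        sb = seesBelow (● ∷ w) gα (p , suc q)
        seesBelow-αγ : sb ≡ seesBelow (○ ∷ w) gγ (p , suc q)
        seesBelow-αγ rewrite northStrip-αγ q =
          firstNonEmpty-cong-local (All-resp-↭ (↭-sym (↭-reverse _)) (All-before (p , suc q) (northStrip-avoids-corner q)))

      SameTile : Tile → Set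
      SameTile y = (validTile (● ∷ w) gα y ≡ validTile (○ ∷ w) gγ y)
                 × (tileWt A B G D T (● ∷ w) gα y ≡ tileWt A B G D T (○ ∷ w) gγ y)

      paddedColumns-αγ : All SameTile (paddedColumns w (upTo (length w)))
      paddedColumns-αγ = All.concat⁺ (All.map⁺ (All.universal paddedColumn (upTo (length w))))
        where
        paddedColumn : ∀ q → All SameTile ((0 , suc q) ∷ map shift (column w q))
        paddedColumn q = (validTile-αγ 0 q , tileWt-αγ 0 q)
                       ∷ All.map⁺ (All.universal (λ (p , q′) → validTile-αγ (suc p) q′ , tileWt-αγ (suc p) q′) (column w q))

    tableauWt-corner-αγ : G *ℚ tableauWt (● ∷ w) gα ≡ A *ℚ tableauWt (○ ∷ w) gγ
    tableauWt-corner-αγ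
      rewrite tableauWt-∷ ● w refl gα | tableauWt-∷ ○ w refl gγ
            | allᵇ-cong-local (All.map proj₁ paddedColumns-αγ)
            | prodℚ-cong-local (All.map proj₂ paddedColumns-αγ)
      with allᵇ (validTile (○ ∷ w) gγ) (paddedColumns w (upTo (length w)))
    ... | true  = solve 3 (λ a g p → g :* (a :* con 1ℚ :* p) := a :* (g :* con 1ℚ :* p)) refl A G
                    (prodℚ (map (tileWt A B G D T (○ ∷ w) gγ) (paddedColumns w (upTo (length w)))))
    ... | false = trans (ℚₚ.*-zeroʳ G) (sym (ℚₚ.*-zeroʳ A))

  rowWts-δ : ∀ w → rowWts δ w ≡ 1ℚ
  rowWts-δ []      = refl
  rowWts-δ (s ∷ w) = trans (cong (rowWt δ (isP s) *ℚ_) (rowWts-δ w)) (rowWt-δ (isP s))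
    where
    rowWt-δ : ∀ b → rowWt δ b *ℚ 1ℚ ≡ 1ℚ
    rowWt-δ true  = refl
    rowWt-δ false = refl

  rowWts-β : ∀ w → rowWts β w ≡ T ^ (length w ℕ.+ zeros w)
  rowWts-β []      = refl
  rowWts-β (○ ∷ w) = cong₂ _*ℚ_ (ℚₚ.*-identityˡ T) (rowWts-β w)
  rowWts-β (● ∷ w) = cong₂ _*ℚ_ (ℚₚ.*-identityˡ T) (rowWts-β w)
  rowWts-β (∗ ∷ w) = begin
      (T *ℚ T) *ℚ 1ℚ *ℚ rowWts β w
        ≡⟨ cong ((T *ℚ T) *ℚ 1ℚ *ℚ_) (rowWts-β w) ⟩
      (T *ℚ T) *ℚ 1ℚ *ℚ T ^ (length w ℕ.+ zeros w)
        ≡⟨ solve 2 (λ t x → (t :* t) :* con 1ℚ :* x := t :* (t :* x)) refl T (T ^ (length w ℕ.+ zeros w)) ⟩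
      T ^ suc (suc (length w ℕ.+ zeros w))
        ≡⟨ cong (λ n → T ^ suc n) (ℕₚ.+-suc (length w) (zeros w)) ⟨
      T ^ (length (∗ ∷ w) ℕ.+ zeros (∗ ∷ w)) ∎

  -- The other contents of the corner violate the border condition, so their terms compute to 0.
  sumTile-corner-● : ∀ w f →
    sumTile (0 , 0) (tableauWt (● ∷ w)) f
      ≡ tableauWt (● ∷ w) (update f (0 , 0) (just α)) + tableauWt (● ∷ w) (update f (0 , 0) (just δ))
  sumTile-corner-● w f =
    solve 2 (λ a d → con 0ℚ :+ (a :+ (con 0ℚ :+ (con 0ℚ :+ (d :+ con 0ℚ)))) := a :+ d) refl
      (tableauWt (● ∷ w) (update f (0 , 0) (just α))) (tableauWt (● ∷ w) (update f (0 , 0) (just δ)))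

  sumTile-corner-○ : ∀ w f →
    sumTile (0 , 0) (tableauWt (○ ∷ w)) f
      ≡ tableauWt (○ ∷ w) (update f (0 , 0) (just β)) + tableauWt (○ ∷ w) (update f (0 , 0) (just γ))
  sumTile-corner-○ w f =
    solve 2 (λ b c → con 0ℚ :+ (con 0ℚ :+ (b :+ (c :+ (con 0ℚ :+ con 0ℚ)))) := b :+ c) refl
      (tableauWt (○ ∷ w) (update f (0 , 0) (just β))) (tableauWt (○ ∷ w) (update f (0 , 0) (just γ)))

  sumTile-corner : ∀ w f →
    G *ℚ sumTile (0 , 0) (tableauWt (● ∷ w)) f + (- A) *ℚ sumTile (0 , 0) (tableauWt (○ ∷ w)) f
      ≡ (G *ℚ D -ℚ A *ℚ B *ℚ T ^ (length w ℕ.+ zeros w)) *ℚ whenTopRowEmpty (upTo (length w)) (tableauWt w) f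
  sumTile-corner w f = begin
      G *ℚ sumTile (0 , 0) (tableauWt (● ∷ w)) f + (- A) *ℚ sumTile (0 , 0) (tableauWt (○ ∷ w)) f
        ≡⟨ cong₂ (λ x y → G *ℚ x + (- A) *ℚ y) (sumTile-corner-● w f) (sumTile-corner-○ w f) ⟩
      G *ℚ (Wα + Wδ) + (- A) *ℚ (Wβ + Wγ)
        ≡⟨ cong₂ (λ d b → G *ℚ (Wα + d) + (- A) *ℚ (b + Wγ)) corner-δ corner-β ⟩
      G *ℚ (Wα + (D *ℚ 1ℚ *ℚ 1ℚ) *ℚ X) + (- A) *ℚ ((B *ℚ 1ℚ *ℚ Tᵏ) *ℚ X + Wγ)
        ≡⟨ solve 8 (λ A B G D Tᵏ Wα Wγ X →
                      G :* (Wα :+ (D :* con 1ℚ :* con 1ℚ) :* X) :+ (:- A) :* ((B :* con 1ℚ :* Tᵏ) :* X :+ Wγ)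
                      := (G :* Wα :- A :* Wγ) :+ (G :* D :- A :* B :* Tᵏ) :* X)
                 refl A B G D Tᵏ Wα Wγ X ⟩
      (G *ℚ Wα -ℚ A *ℚ Wγ) + (G *ℚ D -ℚ A *ℚ B *ℚ Tᵏ) *ℚ X
        ≡⟨ cong (λ x → (x -ℚ A *ℚ Wγ) + (G *ℚ D -ℚ A *ℚ B *ℚ Tᵏ) *ℚ X) (tableauWt-corner-αγ w f) ⟩
      (A *ℚ Wγ -ℚ A *ℚ Wγ) + (G *ℚ D -ℚ A *ℚ B *ℚ Tᵏ) *ℚ X
        ≡⟨ solve 2 (λ y z → (y :- y) :+ z := z) refl (A *ℚ Wγ) ((G *ℚ D -ℚ A *ℚ B *ℚ Tᵏ) *ℚ X) ⟩
      (G *ℚ D -ℚ A *ℚ B *ℚ Tᵏ) *ℚ X ∎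
    where
    Wα = tableauWt (● ∷ w) (update f (0 , 0) (just α))
    Wδ = tableauWt (● ∷ w) (update f (0 , 0) (just δ))
    Wβ = tableauWt (○ ∷ w) (update f (0 , 0) (just β))
    Wγ = tableauWt (○ ∷ w) (update f (0 , 0) (just γ))
    X = whenTopRowEmpty (upTo (length w)) (tableauWt w) f
    Tᵏ = T ^ (length w ℕ.+ zeros w)
    corner-δ : Wδ ≡ (D *ℚ 1ℚ *ℚ 1ℚ) *ℚ X
    corner-δ = trans (tableauWt-corner-βδ ● w refl δ refl f (cornerWestStrip-allEmpty ● w f (just δ)))
                     (cong (λ r → (D *ℚ 1ℚ *ℚ r) *ℚ X) (rowWts-δ w))
    corner-β : Wβ ≡ (B *ℚ 1ℚ *ℚ Tᵏ) *ℚ X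
    corner-β = trans (tableauWt-corner-βδ ○ w refl β refl f (cornerWestStrip-allEmpty ○ w f (just β)))
                     (cong (λ r → (B *ℚ 1ℚ *ℚ r) *ℚ X) (rowWts-β w))

  R-recurrence : ∀ w →
    G *ℚ R A B G D T (● ∷ w) + (- A) *ℚ R A B G D T (○ ∷ w)
      ≡ (G *ℚ D -ℚ A *ℚ B *ℚ T ^ (length w ℕ.+ zeros w)) *ℚ R A B G D T w
  R-recurrence w = begin
      G *ℚ R A B G D T (● ∷ w) + (- A) *ℚ R A B G D T (○ ∷ w)
        ≡⟨ cong₂ (λ x y → G *ℚ x + (- A) *ℚ y) (R-∷ ● refl) (R-∷ ○ refl) ⟩
      G *ℚ sumTiles L Σ● emptyFilling + (- A) *ℚ sumTiles L Σ○ emptyFilling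
        ≡⟨ sumTiles-linear L G (- A) Σ● Σ○ emptyFilling ⟨
      sumTiles L (λ f → G *ℚ Σ● f + (- A) *ℚ Σ○ f) emptyFilling
        ≡⟨ sumTiles-cong L (sumTile-corner w) emptyFilling ⟩
      sumTiles L (λ f → K *ℚ X f) emptyFilling
        ≡⟨ sumTiles-*ˡ L K X emptyFilling ⟩
      K *ℚ sumTiles L X emptyFilling
        ≡⟨ cong (K *ℚ_) (sumTiles-paddedColumns w (upTo⁺ (length w)) (tableauWt w) emptyFilling) ⟩
      K *ℚ sumTiles (tiles w) (tableauWt w) emptyFilling
        ≡⟨ cong (K *ℚ_) (R≡sumTiles w) ⟨
      K *ℚ R A B G D T w ∎
    where
    L = paddedColumns w (upTo (length w))
    K = G *ℚ D -ℚ A *ℚ B *ℚ T ^ (length w ℕ.+ zeros w)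
    X = whenTopRowEmpty (upTo (length w)) (tableauWt w)
    Σ● = sumTile (0 , 0) (tableauWt (● ∷ w))
    Σ○ = sumTile (0 , 0) (tableauWt (○ ∷ w))
    R-∷ : ∀ s → isP s ≡ true → R A B G D T (s ∷ w) ≡ sumTiles L (sumTile (0 , 0) (tableauWt (s ∷ w))) emptyFilling
    R-∷ s s-particle =
      trans (R≡sumTiles (s ∷ w)) (cong (λ ts → sumTiles ts (tableauWt (s ∷ w)) emptyFilling) (tiles-∷ s w s-particle))

  denominator : ℕ → ℚ
  denominator i = A *ℚ B *ℚ T ^ i -ℚ G *ℚ D

  -- Rt A B G D T μ is definitionally normaliser μ *ℚ R A B G D T μ.
  normaliser : List Sign → ℚ
  normaliser μ = (T -ℚ 1ℚ) ^ m *ℚ inv (prodℚ (applyUpTo (λ k → denominator (2 ℕ.* zeros μ ℕ.+ k)) m))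
    where m = length μ ∸ zeros μ

  normaliser-∷ : ∀ s w → isP s ≡ true →
    normaliser (s ∷ w) ≡ ((T -ℚ 1ℚ) *ℚ inv (denominator (length w ℕ.+ zeros w))) *ℚ normaliser w
  normaliser-∷ s w s-particle
    rewrite zeros-particle∷ s w s-particle | ℕₚ.+-∸-assoc 1 (zeros≤length w) = begin
      (T -ℚ 1ℚ) *ℚ e *ℚ inv (prodℚ (applyUpTo h (suc m)))
        ≡⟨ cong (λ P → (T -ℚ 1ℚ) *ℚ e *ℚ inv P) (prodℚ-applyUpTo-suc h m) ⟩
      (T -ℚ 1ℚ) *ℚ e *ℚ inv (prodℚ (applyUpTo h m) *ℚ h m)
        ≡⟨ cong ((T -ℚ 1ℚ) *ℚ e *ℚ_) (inv-* (prodℚ (applyUpTo h m)) (h m)) ⟩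
      (T -ℚ 1ℚ) *ℚ e *ℚ (inv (prodℚ (applyUpTo h m)) *ℚ inv (h m))
        ≡⟨ cong (λ i → (T -ℚ 1ℚ) *ℚ e *ℚ (inv (prodℚ (applyUpTo h m)) *ℚ inv (denominator i)))
                (2r+[M∸r]≡M+r (zeros≤length w)) ⟩
      (T -ℚ 1ℚ) *ℚ e *ℚ (inv (prodℚ (applyUpTo h m)) *ℚ inv (denominator (length w ℕ.+ zeros w)))
        ≡⟨ solve 4 (λ t e p d → t :* e :* (p :* d) := t :* d :* (e :* p)) refl (T -ℚ 1ℚ) e (inv (prodℚ (applyUpTo h m))) _ ⟩
      ((T -ℚ 1ℚ) *ℚ inv (denominator (length w ℕ.+ zeros w))) *ℚ normaliser w ∎
    where
    m = length w ∸ zeros w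
    e = (T -ℚ 1ℚ) ^ m
    h : ℕ → ℚ
    h k = denominator (2 ℕ.* zeros w ℕ.+ k)

  -- Multiply R-recurrence by normaliser (● ∷ w) = normaliser (○ ∷ w): its extra factor
  -- 1 / denominator (|w| + r) cancels G D − A B T^{|w| + r}, leaving (T − 1) · normaliser w.
  Rt-recurrence : ∀ κ ρ w → A ≡ κ *ℚ G → ρ *ℚ G ≡ 1ℚ -ℚ T → G ≢ 0ℚ → denominator (length w ℕ.+ zeros w) ≢ 0ℚ →
    Rt A B G D T (● ∷ w) ≡ κ *ℚ Rt A B G D T (○ ∷ w) + ρ *ℚ Rt A B G D T w
  Rt-recurrence κ ρ w A≡κG ρG≡1-T G≢0 den≢0 = *-cancelˡ G G≢0 (begin
      G *ℚ (normaliser (● ∷ w) *ℚ R●)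
        ≡⟨ cong (λ n → G *ℚ (n *ℚ R●)) (normaliser-∷ ● w refl) ⟩
      G *ℚ (c *ℚ N *ℚ R●)
        ≡⟨ solve 6 (λ G A c N R● R○ → G :* (c :* N :* R●) := c :* N :* (G :* R● :+ (:- A) :* R○) :+ c :* N :* (A :* R○))
                 refl G A c N R● R○ ⟩
      c *ℚ N *ℚ (G *ℚ R● + (- A) *ℚ R○) + c *ℚ N *ℚ (A *ℚ R○)
        ≡⟨ cong₂ (λ x a → c *ℚ N *ℚ x + c *ℚ N *ℚ (a *ℚ R○)) (R-recurrence w) A≡κG ⟩
      c *ℚ N *ℚ ((G *ℚ D -ℚ A *ℚ B *ℚ Tᵏ) *ℚ Rw) + c *ℚ N *ℚ (κ *ℚ G *ℚ R○)
        ≡⟨ solve 11 (λ T i N A B G D Tᵏ Rw κ R○ →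
                      (T :- con 1ℚ) :* i :* N :* ((G :* D :- A :* B :* Tᵏ) :* Rw) :+ (T :- con 1ℚ) :* i :* N :* (κ :* G :* R○)
                      := G :* (κ :* ((T :- con 1ℚ) :* i :* N :* R○)) :+ (con 1ℚ :- T) :* (N :* Rw) :* ((A :* B :* Tᵏ :- G :* D) :* i))
                 refl T i N A B G D Tᵏ Rw κ R○ ⟩
      G *ℚ (κ *ℚ (c *ℚ N *ℚ R○)) + (1ℚ -ℚ T) *ℚ (N *ℚ Rw) *ℚ (denominator k *ℚ i)
        ≡⟨ cong₂ (λ x y → G *ℚ (κ *ℚ (c *ℚ N *ℚ R○)) + x *ℚ (N *ℚ Rw) *ℚ y) (sym ρG≡1-T) (inv-inverseʳ _ den≢0) ⟩
      G *ℚ (κ *ℚ (c *ℚ N *ℚ R○)) + ρ *ℚ G *ℚ (N *ℚ Rw) *ℚ 1ℚ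
        ≡⟨ solve 5 (λ G κ X ρ Y → G :* (κ :* X) :+ ρ :* G :* Y :* con 1ℚ := G :* (κ :* X :+ ρ :* Y))
                 refl G κ (c *ℚ N *ℚ R○) ρ (N *ℚ Rw) ⟩
      G *ℚ (κ *ℚ (c *ℚ N *ℚ R○) + ρ *ℚ (N *ℚ Rw))
        ≡⟨ cong (λ n → G *ℚ (κ *ℚ (n *ℚ R○) + ρ *ℚ (N *ℚ Rw))) (normaliser-∷ ○ w refl) ⟨
      G *ℚ (κ *ℚ (normaliser (○ ∷ w) *ℚ R○) + ρ *ℚ (N *ℚ Rw)) ∎)
    where
    k = length w ℕ.+ zeros w
    Tᵏ = T ^ k
    i = inv (denominator k)
    c = (T -ℚ 1ℚ) *ℚ i
    N = normaliser w
    R● = R A B G D T (● ∷ w)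
    R○ = R A B G D T (○ ∷ w)
    Rw = R A B G D T w

  termSum : (List Sign → List Sign) → List (List Sign × ℚ) → ℚ
  termSum k = sumℚ ∘ map (λ p → Rt A B G D T (k (proj₁ p)) *ℚ proj₂ p)

  termSum-split : ∀ s u L →
    sumℚ (map (λ p → Rt A B G D T (proj₁ p) *ℚ proj₂ p)
              (map (λ p → (s ∷ proj₁ p , proj₂ p)) L ++ map (λ p → (proj₁ p , u *ℚ proj₂ p)) L))
      ≡ termSum (s ∷_) L + u *ℚ termSum (λ w → w) L
  termSum-split s u L = begin
      sumℚ (map φ (map (λ p → (s ∷ proj₁ p , proj₂ p)) L ++ map (λ p → (proj₁ p , u *ℚ proj₂ p)) L))
        ≡⟨ cong sumℚ (List.map-++ φ (map (λ p → (s ∷ proj₁ p , proj₂ p)) L) _) ⟩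
      sumℚ (map φ (map (λ p → (s ∷ proj₁ p , proj₂ p)) L) ++ map φ (map (λ p → (proj₁ p , u *ℚ proj₂ p)) L))
        ≡⟨ sumℚ-++ (map φ (map (λ p → (s ∷ proj₁ p , proj₂ p)) L)) _ ⟩
      sumℚ (map φ (map (λ p → (s ∷ proj₁ p , proj₂ p)) L)) + sumℚ (map φ (map (λ p → (proj₁ p , u *ℚ proj₂ p)) L))
        ≡⟨ cong₂ _+_ (cong sumℚ (sym (List.map-∘ L)))
                     (cong sumℚ (trans (sym (List.map-∘ L)) (List.map-cong (λ p → x∙yz≈y∙xz (Rt A B G D T (proj₁ p)) u (proj₂ p)) L))) ⟩
      termSum (s ∷_) L + sumℚ (map (λ p → u *ℚ φ p) L)
        ≡⟨ cong (termSum (s ∷_) L +_) (sumℚ-*ˡ u φ L) ⟩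
      termSum (s ∷_) L + u *ℚ termSum (λ w → w) L ∎
    where
    φ : List Sign × ℚ → ℚ
    φ p = Rt A B G D T (proj₁ p) *ℚ proj₂ p

  termSum-recurrence : ∀ κ ρ L →
    All (λ p → Rt A B G D T (● ∷ proj₁ p) ≡ κ *ℚ Rt A B G D T (○ ∷ proj₁ p) + ρ *ℚ Rt A B G D T (proj₁ p)) L →
    termSum (● ∷_) L ≡ κ *ℚ termSum (○ ∷_) L + ρ *ℚ termSum (λ w → w) L
  termSum-recurrence κ ρ L recurrences = trans
    (cong sumℚ (List.map-cong-local (All.map (λ {p} e → trans (cong (_*ℚ proj₂ p) e) (distrib p)) recurrences)))
    (sumℚ-linear κ ρ (λ p → Rt A B G D T (○ ∷ proj₁ p) *ℚ proj₂ p) (λ p → Rt A B G D T (proj₁ p) *ℚ proj₂ p) L)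
    where
    distrib : ∀ p → (κ *ℚ Rt A B G D T (○ ∷ proj₁ p) + ρ *ℚ Rt A B G D T (proj₁ p)) *ℚ proj₂ p
                  ≡ κ *ℚ (Rt A B G D T (○ ∷ proj₁ p) *ℚ proj₂ p) + ρ *ℚ (Rt A B G D T (proj₁ p) *ℚ proj₂ p)
    distrib p = solve 5 (λ κ x ρ y c → (κ :* x :+ ρ :* y) :* c := κ :* (x :* c) :+ ρ :* (y :* c))
                      refl κ (Rt A B G D T (○ ∷ proj₁ p)) ρ (Rt A B G D T (proj₁ p)) (proj₂ p)

  F-○∷ : ∀ {n} (x : Vec Sign n) z zs →
    F A B G D T (○ ∷ x) (z ∷ zs) ≡ termSum (○ ∷_) (terms x zs) + (inv z -ℚ 1ℚ) *ℚ termSum (λ w → w) (terms x zs)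
  F-○∷ x z zs = termSum-split ○ (inv z -ℚ 1ℚ) (terms x zs)

  F-●∷ : ∀ {n} (x : Vec Sign n) z zs →
    F A B G D T (● ∷ x) (z ∷ zs) ≡ termSum (● ∷_) (terms x zs) + (z -ℚ 1ℚ) *ℚ termSum (λ w → w) (terms x zs)
  F-●∷ x z zs = termSum-split ● (z -ℚ 1ℚ) (terms x zs)

-- The operator T̃₀ and the change of variables

qT̃₀-affine : ∀ {n} (a c q P S : ℚ) (f : Vec ℚ (suc n) → ℚ) z zs →
  q ≢ 0ℚ → z ≢ 0ℚ → z -ℚ q *ℚ inv z ≢ 0ℚ → (∀ y → f (y ∷ zs) ≡ P + (inv y -ℚ 1ℚ) *ℚ S) →
  q *ℚ T̃₀ a c q f (z ∷ zs) ≡ (- (a *ℚ c)) *ℚ P + ((1ℚ -ℚ a) *ℚ (1ℚ -ℚ c)) *ℚ S + (z -ℚ 1ℚ) *ℚ S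
qT̃₀-affine a c q P S f z zs q≢0 z≢0 D≢0 f-affine = begin
    q *ℚ (- (a *ℚ c *ℚ q⁻¹) *ℚ f (z ∷ zs) -ℚ K *ℚ ((f (z ∷ zs) -ℚ f (q *ℚ z⁻¹ ∷ zs)) *ℚ D⁻¹))
      ≡⟨ cong₂ (λ u v → q *ℚ (- (a *ℚ c *ℚ q⁻¹) *ℚ u -ℚ K *ℚ ((u -ℚ v) *ℚ D⁻¹)))
               (f-affine z) (f-affine (q *ℚ z⁻¹)) ⟩
    q *ℚ (- (a *ℚ c *ℚ q⁻¹) *ℚ F₁ -ℚ K *ℚ ((F₁ -ℚ (P + (inv (q *ℚ z⁻¹) -ℚ 1ℚ) *ℚ S)) *ℚ D⁻¹))
      ≡⟨ cong (λ d → q *ℚ (- (a *ℚ c *ℚ q⁻¹) *ℚ F₁ -ℚ K *ℚ d)) difference-quotient ⟩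
    q *ℚ (- (a *ℚ c *ℚ q⁻¹) *ℚ F₁ -ℚ K *ℚ (- (q⁻¹ *ℚ S)))
      ≡⟨ solve 8 (λ a c q q⁻¹ z z⁻¹ P S →
           q :* (:- (a :* c :* q⁻¹) :* (P :+ (z⁻¹ :- con 1ℚ) :* S) :- (z :- a) :* (z :- c) :* z⁻¹ :* (:- (q⁻¹ :* S)))
           := (:- (a :* c)) :* P :+ (con 1ℚ :- a) :* (con 1ℚ :- c) :* S :+ (z :- con 1ℚ) :* S
              :+ (q :* q⁻¹ :- con 1ℚ) :* ((:- (a :* c)) :* P :+ a :* c :* S :+ (z :* z⁻¹) :* (z :- a :- c) :* S)
              :+ (z :* z⁻¹ :- con 1ℚ) :* ((z :- a :- c) :* S))
           refl a c q q⁻¹ z z⁻¹ P S ⟩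
    RHS + (q *ℚ q⁻¹ -ℚ 1ℚ) *ℚ X + (z *ℚ z⁻¹ -ℚ 1ℚ) *ℚ Y
      ≡⟨ cong₂ (λ u v → RHS + (u -ℚ 1ℚ) *ℚ X + (v -ℚ 1ℚ) *ℚ Y) (inv-inverseʳ q q≢0) (inv-inverseʳ z z≢0) ⟩
    RHS + (1ℚ -ℚ 1ℚ) *ℚ X + (1ℚ -ℚ 1ℚ) *ℚ Y
      ≡⟨ solve 3 (λ r x y → r :+ (con 1ℚ :- con 1ℚ) :* x :+ (con 1ℚ :- con 1ℚ) :* y := r) refl RHS X Y ⟩
    RHS ∎
  where
  q⁻¹ = inv q
  z⁻¹ = inv z
  D⁻¹ = inv (z -ℚ q *ℚ z⁻¹)
  K = (z -ℚ a) *ℚ (z -ℚ c) *ℚ z⁻¹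
  F₁ = P + (z⁻¹ -ℚ 1ℚ) *ℚ S
  RHS = (- (a *ℚ c)) *ℚ P + ((1ℚ -ℚ a) *ℚ (1ℚ -ℚ c)) *ℚ S + (z -ℚ 1ℚ) *ℚ S
  -- the cofactors of q q⁻¹ − 1 and z z⁻¹ − 1 in the difference of the two sides
  X = (- (a *ℚ c)) *ℚ P + a *ℚ c *ℚ S + (z *ℚ z⁻¹) *ℚ (z -ℚ a -ℚ c) *ℚ S
  Y = (z -ℚ a -ℚ c) *ℚ S
  difference-quotient : (F₁ -ℚ (P + (inv (q *ℚ z⁻¹) -ℚ 1ℚ) *ℚ S)) *ℚ D⁻¹ ≡ - (q⁻¹ *ℚ S)
  difference-quotient = begin
      (F₁ -ℚ (P + (inv (q *ℚ z⁻¹) -ℚ 1ℚ) *ℚ S)) *ℚ D⁻¹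
        ≡⟨ cong (λ v → (F₁ -ℚ (P + (v -ℚ 1ℚ) *ℚ S)) *ℚ D⁻¹)
                (trans (inv-* q z⁻¹) (cong (q⁻¹ *ℚ_) (inv-involutive z z≢0))) ⟩
      (F₁ -ℚ (P + (q⁻¹ *ℚ z -ℚ 1ℚ) *ℚ S)) *ℚ D⁻¹
        ≡⟨ solve 7 (λ P S q q⁻¹ z z⁻¹ D⁻¹ →
             (P :+ (z⁻¹ :- con 1ℚ) :* S :- (P :+ (q⁻¹ :* z :- con 1ℚ) :* S)) :* D⁻¹
             := (:- (q⁻¹ :* S)) :* ((z :- q :* z⁻¹) :* D⁻¹) :- (q :* q⁻¹ :- con 1ℚ) :* (z⁻¹ :* S :* D⁻¹))
             refl P S q q⁻¹ z z⁻¹ D⁻¹ ⟩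
      - (q⁻¹ *ℚ S) *ℚ ((z -ℚ q *ℚ z⁻¹) *ℚ D⁻¹) -ℚ (q *ℚ q⁻¹ -ℚ 1ℚ) *ℚ (z⁻¹ *ℚ S *ℚ D⁻¹)
        ≡⟨ cong₂ (λ u v → - (q⁻¹ *ℚ S) *ℚ u -ℚ (v -ℚ 1ℚ) *ℚ (z⁻¹ *ℚ S *ℚ D⁻¹))
                 (inv-inverseʳ _ D≢0) (inv-inverseʳ q q≢0) ⟩
      - (q⁻¹ *ℚ S) *ℚ 1ℚ -ℚ (1ℚ -ℚ 1ℚ) *ℚ (z⁻¹ *ℚ S *ℚ D⁻¹)
        ≡⟨ solve 2 (λ u y → (:- u) :* con 1ℚ :- (con 1ℚ :- con 1ℚ) :* y := :- u) refl (q⁻¹ *ℚ S) (z⁻¹ *ℚ S *ℚ D⁻¹) ⟩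
      - (q⁻¹ *ℚ S) ∎

αv≡-ac·γv : ∀ a b c d t → αv a b c d t ≡ (- (a *ℚ c)) *ℚ γv a b c d t
αv≡-ac·γv a b c d t =
  solve 4 (λ a c t i → (:- (a :* c :* (con 1ℚ :- t))) :* i := (:- (a :* c)) :* ((con 1ℚ :- t) :* i))
        refl a c t (inv ((a -ℚ 1ℚ) *ℚ (c -ℚ 1ℚ)))

[1-a][1-c]·γv≡1-t : ∀ a b c d t → a ≢ 1ℚ → c ≢ 1ℚ → ((1ℚ -ℚ a) *ℚ (1ℚ -ℚ c)) *ℚ γv a b c d t ≡ 1ℚ -ℚ t
[1-a][1-c]·γv≡1-t a b c d t a≢1 c≢1 = begin
    ((1ℚ -ℚ a) *ℚ (1ℚ -ℚ c)) *ℚ ((1ℚ -ℚ t) *ℚ inv X)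
      ≡⟨ solve 4 (λ a c t i → ((con 1ℚ :- a) :* (con 1ℚ :- c)) :* ((con 1ℚ :- t) :* i)
                              := (con 1ℚ :- t) :* (((a :- con 1ℚ) :* (c :- con 1ℚ)) :* i)) refl a c t (inv X) ⟩
    (1ℚ -ℚ t) *ℚ (X *ℚ inv X)
      ≡⟨ cong ((1ℚ -ℚ t) *ℚ_) (inv-inverseʳ X (*-≢0 (-≢0 a≢1) (-≢0 c≢1))) ⟩
    (1ℚ -ℚ t) *ℚ 1ℚ
      ≡⟨ ℚₚ.*-identityʳ (1ℚ -ℚ t) ⟩
    1ℚ -ℚ t ∎
  where X = (a -ℚ 1ℚ) *ℚ (c -ℚ 1ℚ)

γv≢0 : ∀ a b c d t → a ≢ 1ℚ → c ≢ 1ℚ → t ≢ 1ℚ → γv a b c d t ≢ 0ℚ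
γv≢0 a b c d t a≢1 c≢1 t≢1 = *-≢0 (-≢0 (t≢1 ∘ sym)) (inv-≢0 (*-≢0 (-≢0 a≢1) (-≢0 c≢1)))

-- At t = 1 all of α, β, γ, δ vanish.
den0≢0⇒t≢1 : ∀ a b c d t → den a b c d t 0 ≢ 0ℚ → t ≢ 1ℚ
den0≢0⇒t≢1 a b c d t den≢0 refl = den≢0
  (solve 6 (λ a b c d i j → (:- (a :* c :* (con 1ℚ :- con 1ℚ))) :* i :* ((:- (b :* d :* (con 1ℚ :- con 1ℚ))) :* j) :* con 1ℚ
                           :- ((con 1ℚ :- con 1ℚ) :* i) :* ((con 1ℚ :- con 1ℚ) :* j) := con 0ℚ)
         refl a b c d (inv ((a -ℚ 1ℚ) *ℚ (c -ℚ 1ℚ))) (inv ((b -ℚ 1ℚ) *ℚ (d -ℚ 1ℚ))))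

Rtabcd : (a b c d t : ℚ) → List Sign → ℚ
Rtabcd a b c d t = Rt (αv a b c d t) (βv a b c d t) (γv a b c d t) (δv a b c d t) t

Rtabcd-recurrence : ∀ a b c d t w → a ≢ 1ℚ → c ≢ 1ℚ → t ≢ 1ℚ → den a b c d t (length w ℕ.+ zeros w) ≢ 0ℚ →
  Rtabcd a b c d t (● ∷ w) ≡ (- (a *ℚ c)) *ℚ Rtabcd a b c d t (○ ∷ w) + ((1ℚ -ℚ a) *ℚ (1ℚ -ℚ c)) *ℚ Rtabcd a b c d t w
Rtabcd-recurrence a b c d t w a≢1 c≢1 t≢1 =
  WeightsAt.Rt-recurrence (αv a b c d t) (βv a b c d t) (γv a b c d t) (δv a b c d t) t (- (a *ℚ c)) ((1ℚ -ℚ a) *ℚ (1ℚ -ℚ c)) w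
    (αv≡-ac·γv a b c d t) ([1-a][1-c]·γv≡1-t a b c d t a≢1 c≢1) (γv≢0 a b c d t a≢1 c≢1 t≢1)

terms-length : ∀ {n} (x : Vec Sign n) zs → All (λ p → length (proj₁ p) ≤ n) (terms x zs)
terms-length []      []       = z≤n ∷ []
terms-length (∗ ∷ x) (z ∷ zs) = All.map⁺ (All.map s≤s (terms-length x zs))
terms-length (○ ∷ x) (z ∷ zs) =
  All.++⁺ (All.map⁺ (All.map s≤s (terms-length x zs))) (All.map⁺ (All.map ℕₚ.m≤n⇒m≤1+n (terms-length x zs)))
terms-length (● ∷ x) (z ∷ zs) =
  All.++⁺ (All.map⁺ (All.map s≤s (terms-length x zs))) (All.map⁺ (All.map ℕₚ.m≤n⇒m≤1+n (terms-length x zs)))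

length+zeros<2*suc : ∀ {n} w → length w ≤ n → length w ℕ.+ zeros w < 2 * suc n
length+zeros<2*suc {n} w M≤n =
  s≤s (ℕₚ.+-mono-≤ M≤n (ℕₚ.≤-trans (ℕₚ.≤-trans (zeros≤length w) M≤n) (ℕₚ.m≤n⇒m≤1+n (ℕₚ.m≤m+n n 0))))

theorem3p8 : ∀ {n} (x : Vec Sign n) (a b c d q t : ℚ) (z : Vec ℚ (suc n)) →
    a ≢ 1ℚ → b ≢ 1ℚ → c ≢ 1ℚ → d ≢ 1ℚ → q ≢ 0ℚ →
    (∀ i → lookup z i ≢ 0ℚ) →
    head z -ℚ q *ℚ inv (head z) ≢ 0ℚ →
    (∀ i → i < 2 * suc n → den a b c d t i ≢ 0ℚ) →
    q *ℚ T̃₀ a c q (Fabcd a b c d t (○ ∷ x)) z ≡ Fabcd a b c d t (● ∷ x) z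
theorem3p8 {n} x a b c d q t (z ∷ zs) a≢1 _ c≢1 _ q≢0 z≢0 D≢0 den≢0 = begin
    q *ℚ T̃₀ a c q (Fabcd a b c d t (○ ∷ x)) (z ∷ zs)
      ≡⟨ qT̃₀-affine a c q (termSum (○ ∷_) L) S (Fabcd a b c d t (○ ∷ x)) z zs q≢0 (z≢0 zero) D≢0 (λ y → F-○∷ x y zs) ⟩
    κ *ℚ termSum (○ ∷_) L + ρ *ℚ S + (z -ℚ 1ℚ) *ℚ S
      ≡⟨ cong (_+ (z -ℚ 1ℚ) *ℚ S) (termSum-recurrence κ ρ L (All.map (λ {p} → recurrence {p}) (terms-length x zs))) ⟨
    termSum (● ∷_) L + (z -ℚ 1ℚ) *ℚ S
      ≡⟨ F-●∷ x z zs ⟨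
    Fabcd a b c d t (● ∷ x) (z ∷ zs) ∎
  where
  open WeightsAt (αv a b c d t) (βv a b c d t) (γv a b c d t) (δv a b c d t) t
  κ = - (a *ℚ c)
  ρ = (1ℚ -ℚ a) *ℚ (1ℚ -ℚ c)
  L = terms x zs
  S = termSum (λ w → w) L
  R̃ = Rtabcd a b c d t
  recurrence : ∀ {p} → length (proj₁ p) ≤ n → R̃ (● ∷ proj₁ p) ≡ κ *ℚ R̃ (○ ∷ proj₁ p) + ρ *ℚ R̃ (proj₁ p)
  recurrence {p} M≤n = Rtabcd-recurrence a b c d t (proj₁ p) a≢1 c≢1 (den0≢0⇒t≢1 a b c d t (den≢0 0 (s≤s z≤n)))
                                         (den≢0 _ (length+zeros<2*suc (proj₁ p) M≤n))
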